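{- Let $\phi$ be a \textsc{3Sat} instance with variables $x_1,\dots,x_N$ and clauses $C_1,\dots,C_M$, in which every clause involves exactly $3$ distinct variables and every variable appears in exactly $d$ clauses, where $d$ is a constant. Let $G_\phi$ be its clause/variable game and $G_\phi^{k\times\ell}$ its birthday repetition. Then there is a constant $C$ (depending only on $d$) such that for all $k\in[M]$ and $\ell\in[N]$, $$\omega(G_\phi)\ \ge\ \omega(G_\phi^{k\times\ell})-C\sqrt{\frac{N}{k\ell}}.$$
   Context: A two-prover game $G=(X,Y,A,B,\mathcal{D},V)$ has finite question sets $X,Y$, answer sets $A,B$, a distribution $\mathcal{D}$ on $X\times Y$, and $V:X\times Y\times A\times B\to[0,1]$; its value is $\omega(G)=\max_{a:X\to A,b:Y\to B}\mathbb{E}_{(x,y)\sim\mathcal{D}}[V(x,y,a(x),b(y))]$. The clause/variable game $G_\phi$: the verifier picks $i\in[M]$ uniformly, then $j\in[N]$ uniformly among the indices of variables occurring in $C_i$; he sends $i$ to prover 1 and $j$ to prover 2; prover 1 answers an assignment to the three variables of $C_i$, prover 2 answers a bit for $x_j$; the verifier accepts ($V=1$) iff prover 1's assignment satisfies $C_i$ and agrees with prover 2's bit on $x_j$. Thus $\mathcal{D}$ is uniform on a subset $Z\subseteq[M]\times[N]$ (the pairs with $x_j$ occurring in $C_i$), with $\{0,1\}$-valued $V$. Birthday repetition: for a game with $\{0,1\}$-valued $V$ and $\mathcal{D}$ uniform on $Z\subseteq X\times Y$, and integers $k\le|X|$, $\ell\le|Y|$, the free game $G^{k\times\ell}$ has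 the verifier choose uniformly random $S\subseteq X$ with $|S|=k$ and $T\subseteq Y$ with $|T|=\ell$ (independently), send $S$ to prover 1 (who answers $a:S\to A$) and $T$ to prover 2 (who answers $b:T\to B$), and accept iff $V(x,y,a(x),b(y))=1$ for all $(x,y)\in(S\times T)\cap Z$ (so he always accepts if this intersection is empty). Its value is the maximum acceptance probability over prover strategies (functions from question sets to answers). -}

module Defs where

open import Data.Nat as ℕ using (ℕ; zero; suc; _+_; _*_)
open import Data.Nat.Combinatorics using (_C_)
open import Data.Bool using (Bool; true; false; _∧_; _∨_; not; if_then_else_)
open import Data.Fin using (Fin; zero; suc)
import Data.Fin.Properties as FinP
open import Data.Fin.Subset using (Subset; ∣_∣; inside; outside)
open import Data.Vec using (Vec; []; _∷_; lookup)
open import Data.Product using (_×_; _,_; proj₁; proj₂; ∃-syntax)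
open import Data.Sum using (_⊎_)
open import Data.Integer using (+_)
open import Data.Rational using (ℚ; _/_; _-_; _≤_) renaming (_*_ to _*ℚ_)
open import Relation.Nullary.Decidable using (⌊_⌋)
open import Relation.Binary.PropositionalEquality using (_≡_)

sumFin : (n : ℕ) → (Fin n → ℕ) → ℕ
sumFin zero    f = 0
sumFin (suc n) f = f zero + sumFin n (λ i → f (suc i))

allFin : (n : ℕ) → (Fin n → Bool) → Bool
allFin zero    p = true
allFin (suc n) p = p zero ∧ allFin n (λ i → p (suc i))

anyFin : (n : ℕ) → (Fin n → Bool) → Bool
anyFin zero    p = false
anyFin (suc n) p = p zero ∨ anyFin n (λ i → p (suc i))

sumSub : (n : ℕ) → (Subset n → ℕ) → ℕ
sumSub zero    f = f []
sumSub (suc n) f = sumSub n (λ s → f (outside ∷ s)) + sumSub n (λ s → f (inside ∷ s))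

ind : Bool → ℕ
ind true  = 1
ind false = 0

-- the rational a / n (with the irrelevant convention a / 0 = 0)
frac : ℕ → ℕ → ℚ
frac a zero    = + 0 / 1
frac a (suc n) = + a / suc n

ℕtoℚ : ℕ → ℚ
ℕtoℚ n = + n / 1

_==ᵇ_ : Bool → Bool → Bool
true  ==ᵇ b = b
false ==ᵇ b = not b

-- 3SAT instances: N variables, M clauses.  A clause is given by its three
-- literals, each a variable index together with a polarity (true = positive
-- literal x_j, false = negated literal ¬x_j).

Literal : ℕ → Set
Literal N = Fin N × Bool

Clause : ℕ → Set
Clause N = Fin 3 → Literal N

CNF : ℕ → ℕ → Set
CNF N M = Fin M → Clause N

var : ∀ {N M} → CNF N M → Fin M → Fin 3 → Fin N
var φ i t = proj₁ (φ i t)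

DistinctVars : ∀ {N M} → CNF N M → Set
DistinctVars {N} {M} φ = ∀ (i : Fin M) (t t′ : Fin 3) → var φ i t ≡ var φ i t′ → t ≡ t′

occurs : ∀ {N M} → CNF N M → Fin M → Fin N → Bool
occurs φ i j = anyFin 3 (λ t → ⌊ FinP._≟_ (var φ i t) j ⌋)

Regular : ∀ {N M} → ℕ → CNF N M → Set
Regular {N} {M} d φ = ∀ (j : Fin N) → sumFin M (λ i → ind (occurs φ i j)) ≡ d

-- an answer of prover 1 to clause i: bits for the 3 variables of C_i
-- (listed in the order of the literals of C_i)
ClauseAssignment : Set
ClauseAssignment = Fin 3 → Bool

satisfies : ∀ {N} → Clause N → ClauseAssignment → Bool
satisfies c α = anyFin 3 (λ t → α t ==ᵇ proj₂ (c t))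

-- V(i, j, α, β) for the question pair (i, var φ i t)
accepts : ∀ {N M} → CNF N M → Fin M → Fin 3 → ClauseAssignment → Bool → Bool
accepts φ i t α β = satisfies (φ i) α ∧ (α t ==ᵇ β)

-- D is uniform on Z = {(i,j) : x_j occurs in C_i}; since clause variables
-- are distinct, (i, j) ∈ Z corresponds to (i, t) with t ∈ Fin 3, |Z| = 3M.

Strat₁ : ℕ → Set
Strat₁ M = Fin M → ClauseAssignment

Strat₂ : ℕ → Set
Strat₂ N = Fin N → Bool

valueG : ∀ {N M} → CNF N M → Strat₁ M → Strat₂ N → ℚ
valueG {N} {M} φ a b =
  frac (sumFin M (λ i → sumFin 3 (λ t → ind (accepts φ i t (a i) (b (var φ i t))))))
       (3 * M)

-- Prover 1 gets S ⊆ [M] (|S| = k) and answers a function S → A, represented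
-- as a total function Fin M → A whose values outside S are ignored;
-- prover 2 likewise with T ⊆ [N] (|T| = ℓ).

RepStrat₁ : ℕ → Set
RepStrat₁ M = Subset M → Fin M → ClauseAssignment

RepStrat₂ : ℕ → Set
RepStrat₂ N = Subset N → Fin N → Bool

acceptsRep : ∀ {N M} → CNF N M → Subset M → Subset N →
             (Fin M → ClauseAssignment) → (Fin N → Bool) → Bool
acceptsRep {N} {M} φ S T α β =
  allFin M (λ i → allFin 3 (λ t →
    not (lookup S i ∧ lookup T (var φ i t)) ∨ accepts φ i t (α i) (β (var φ i t))))

valueRep : ∀ {N M} → CNF N M → (k ℓ : ℕ) → RepStrat₁ M → RepStrat₂ N → ℚ
valueRep {N} {M} φ k ℓ A B =
  frac (sumSub M (λ S → sumSub N (λ T →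
          ind (⌊ ∣ S ∣ ℕ.≟ k ⌋ ∧ ⌊ ∣ T ∣ ℕ.≟ ℓ ⌋ ∧ acceptsRep φ S T (A S) (B T)))))
       ((M C k) * (N C ℓ))

-- "q ≥ p − C·√(N/(kℓ))" for C ≥ 0, k, ℓ ≥ 1, expressed without square roots:
-- either p − q ≤ 0, or (p − q)² · kℓ ≤ C² · N.

GapBound : (C : ℚ) (N k ℓ : ℕ) (p q : ℚ) → Set
GapBound C N k ℓ p q =
  (p - q ≤ ℕtoℚ 0) ⊎ (((p - q) *ℚ (p - q)) *ℚ ℕtoℚ (k * ℓ) ≤ (C *ℚ C) *ℚ ℕtoℚ N)

module Submission where

-- Fix strategies A, B of G_φ^{k×ℓ}.  An edge is a pair (i, t): clause i and
-- the slot t of one of its variables.  For a legal question pair (S, T) let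
-- X(S,T) count the edges in S × T, and let n be the number of legal pairs,
-- m = Σ X = 3M·K·L their total (K, L: legal sets through a given clause,
-- resp. variable), P the number of pairs won and U = Σ (m ∸ n·X).
--  * Best response (Part 1): the pairs' accepted edges number at most K·L·Q,
--    where Q counts the edges accepted by strategies (a, b) for G_φ chosen
--    answer by answer as the best that A resp. B ever offers.
--  * Moments (Parts 2, 3): the second moment of X exceeds m²/n only through
--    edges sharing a clause or a variable; by d-regularity, Cauchy–Schwarz
--    and a truncated variance bound give U²·kℓ ≤ (2+d)·N·(n·m)².
--  * Since m·[won] ≤ n·[won]·X + (m ∸ n·X) pointwise, m·P ≤ n·K·L·Q + U;
--    dividing by n·m in ℚ yields (P/n − Q/3M)²·kℓ ≤ (2+d)²·N.

open import Defs
open import Data.Nat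
open import Data.Nat.Properties
open import Data.Nat.Combinatorics using (nCk+nC[k+1]≡[n+1]C[k+1]; k>n⇒nCk≡0; nC1≡n) renaming (_C_ to _choose_)
open import Data.Nat.Tactic.RingSolver using (solve-∀)
open import Data.Bool using (Bool; true; false; _∧_; _∨_; not)
open import Data.Fin using (Fin; zero; suc)
import Data.Fin.Properties as FinP
open import Data.Fin.Subset using (Subset; inside; outside; ∣_∣)
open import Data.Vec using ([]; _∷_; lookup)
open import Data.Product using (_×_; _,_; proj₁; proj₂; ∃-syntax)
open import Data.Sum using (inj₁; inj₂)
open import Data.Empty using (⊥-elim)
open import Function using (_∘′_)
open import Relation.Nullary using (¬_; yes; no; does)
open import Relation.Nullary.Decidable using (⌊_⌋)
open import Relation.Binary.PropositionalEquality
import Data.Integer as ℤ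
import Data.Integer.Properties as ℤP
open import Data.Rational using (ℚ; toℚᵘ; NonNegative; Positive)
  renaming (_≤_ to _≤ℚ_; 0ℚ to 0ℚ; _+_ to _+ℚ_; _*_ to _*ℚ_; _-_ to _-ℚ_; _≤?_ to _≤ℚ?_)
import Data.Rational as ℚ
import Data.Rational.Properties as ℚP
open import Data.Rational.Unnormalised using (mkℚᵘ; *≡*; *≤*) renaming (_≃_ to _≃ᵘ_)
import Data.Rational.Unnormalised.Properties as ℚᵘP
open import Data.Rational.Solver using (module +-*-Solver)

-- A summation over an index type I: an extensional, additive functional.
-- Every sum in the proof (over clauses, literal slots, subsets, and nestings
-- of these) is one, so linearity facts are proved once, here.
record IsSum {I : Set} (σ : (I → ℕ) → ℕ) : Set where
  field
    σ-cong : ∀ {f g : I → ℕ} → (∀ x → f x ≡ g x) → σ f ≡ σ g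
    σ-0    : σ (λ _ → 0) ≡ 0
    σ-+    : ∀ (f g : I → ℕ) → σ (λ x → f x + g x) ≡ σ f + σ g

  σ-mono : ∀ {f g : I → ℕ} → (∀ x → f x ≤ g x) → σ f ≤ σ g
  σ-mono {f} {g} f≤g = begin
    σ f                       ≤⟨ m≤m+n (σ f) (σ (λ x → g x ∸ f x)) ⟩
    σ f + σ (λ x → g x ∸ f x) ≡⟨ σ-+ f (λ x → g x ∸ f x) ⟨
    σ (λ x → f x + (g x ∸ f x)) ≡⟨ σ-cong (λ x → m+[n∸m]≡n (f≤g x)) ⟩
    σ g                       ∎
    where open ≤-Reasoning

  σ-*ˡ : ∀ (c : ℕ) (f : I → ℕ) → σ (λ x → c * f x) ≡ c * σ f
  σ-*ˡ zero    f = σ-0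
  σ-*ˡ (suc c) f = trans (σ-+ f (λ x → c * f x)) (cong (σ f +_) (σ-*ˡ c f))

  σ-*ʳ : ∀ (c : ℕ) (f : I → ℕ) → σ (λ x → f x * c) ≡ σ f * c
  σ-*ʳ c f = trans (σ-cong (λ x → *-comm (f x) c)) (trans (σ-*ˡ c f) (*-comm c (σ f)))

open IsSum public

σ-product : ∀ {I J : Set} {σ : (I → ℕ) → ℕ} {τ : (J → ℕ) → ℕ} → IsSum σ → IsSum τ →
            ∀ (f : I → ℕ) (g : J → ℕ) → σ f * τ g ≡ σ (λ x → τ (λ y → f x * g y))
σ-product Σσ Στ f g =
  trans (sym (σ-*ʳ Σσ _ f)) (σ-cong Σσ (λ x → sym (σ-*ˡ Στ (f x) g)))

σ-nested : ∀ {I J : Set} {σ : (I → ℕ) → ℕ} {τ : (J → ℕ) → ℕ} → IsSum σ → IsSum τ →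
           IsSum (λ (f : I × J → ℕ) → σ (λ x → τ (λ y → f (x , y))))
σ-nested Σσ Στ = record
  { σ-cong = λ e → σ-cong Σσ (λ x → σ-cong Στ (λ y → e (x , y)))
  ; σ-0    = trans (σ-cong Σσ (λ _ → σ-0 Στ)) (σ-0 Σσ)
  ; σ-+    = λ f g → trans (σ-cong Σσ (λ _ → σ-+ Στ _ _)) (σ-+ Σσ _ _) }

sumFin-isSum : ∀ n → IsSum (sumFin n)
sumFin-isSum n = record { σ-cong = sum-cong n ; σ-0 = sum-zero n ; σ-+ = sum-+ n }
  where
  sum-cong : ∀ n {f g : Fin n → ℕ} → (∀ x → f x ≡ g x) → sumFin n f ≡ sumFin n g
  sum-cong zero    e = refl
  sum-cong (suc n) e = cong₂ _+_ (e zero) (sum-cong n (λ x → e (suc x)))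
  sum-zero : ∀ n → sumFin n (λ _ → 0) ≡ 0
  sum-zero zero    = refl
  sum-zero (suc n) = sum-zero n
  sum-+ : ∀ n (f g : Fin n → ℕ) → sumFin n (λ x → f x + g x) ≡ sumFin n f + sumFin n g
  sum-+ zero    f g = refl
  sum-+ (suc n) f g = trans (cong (f zero + g zero +_) (sum-+ n (λ x → f (suc x)) (λ x → g (suc x))))
                           (+-+-interchange (f zero) (g zero) _ _)
    where +-+-interchange : ∀ a b c d → (a + b) + (c + d) ≡ (a + c) + (b + d)
          +-+-interchange = solve-∀

sumSub-isSum : ∀ n → IsSum (sumSub n)
sumSub-isSum n = record { σ-cong = sum-cong n ; σ-0 = sum-zero n ; σ-+ = sum-+ n }
  where
  sum-cong : ∀ n {f g : Subset n → ℕ} → (∀ x → f x ≡ g x) → sumSub n f ≡ sumSub n g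
  sum-cong zero    e = e []
  sum-cong (suc n) e = cong₂ _+_ (sum-cong n (λ s → e (outside ∷ s))) (sum-cong n (λ s → e (inside ∷ s)))
  sum-zero : ∀ n → sumSub n (λ _ → 0) ≡ 0
  sum-zero zero    = refl
  sum-zero (suc n) = cong₂ _+_ (sum-zero n) (sum-zero n)
  sum-+ : ∀ n (f g : Subset n → ℕ) → sumSub n (λ x → f x + g x) ≡ sumSub n f + sumSub n g
  sum-+ zero    f g = refl
  sum-+ (suc n) f g =
    trans (cong₂ _+_ (sum-+ n (λ s → f (outside ∷ s)) (λ s → g (outside ∷ s)))
                     (sum-+ n (λ s → f (inside ∷ s)) (λ s → g (inside ∷ s))))
          (+-+-interchange (sumSub n (λ s → f (outside ∷ s))) (sumSub n (λ s → g (outside ∷ s)))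
                           (sumSub n (λ s → f (inside ∷ s))) (sumSub n (λ s → g (inside ∷ s))))
    where +-+-interchange : ∀ a b c d → (a + b) + (c + d) ≡ (a + c) + (b + d)
          +-+-interchange = solve-∀

sumFin-swap : ∀ {I : Set} {σ : (I → ℕ) → ℕ} → IsSum σ → ∀ n (f : Fin n → I → ℕ) →
              sumFin n (λ i → σ (f i)) ≡ σ (λ x → sumFin n (λ i → f i x))
sumFin-swap Σσ zero    f = sym (σ-0 Σσ)
sumFin-swap {σ = σ} Σσ (suc n) f =
  trans (cong (σ (f zero) +_) (sumFin-swap Σσ n (λ i → f (suc i)))) (sym (σ-+ Σσ (f zero) _))

sumSub-swap : ∀ {I : Set} {σ : (I → ℕ) → ℕ} → IsSum σ → ∀ n (f : Subset n → I → ℕ) →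
              sumSub n (λ S → σ (f S)) ≡ σ (λ x → sumSub n (λ S → f S x))
sumSub-swap Σσ zero    f = refl
sumSub-swap Σσ (suc n) f =
  trans (cong₂ _+_ (sumSub-swap Σσ n (λ S → f (outside ∷ S))) (sumSub-swap Σσ n (λ S → f (inside ∷ S))))
        (sym (σ-+ Σσ _ _))

sumFin-const : ∀ n c → sumFin n (λ _ → c) ≡ n * c
sumFin-const zero    c = refl
sumFin-const (suc n) c = cong (c +_) (sumFin-const n c)

-- 2ab ≤ a² + b² over ℕ: for a ≤ b write b = a + c and expand.
two-mul≤sq+sq-ordered : ∀ {a b} → a ≤ b → 2 * (a * b) ≤ a * a + b * b
two-mul≤sq+sq-ordered {a} {b} a≤b = subst (λ b → 2 * (a * b) ≤ a * a + b * b) (m+[n∸m]≡n a≤b)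
                                          (subst₂ _≤_ (lhs a (b ∸ a)) (rhs a (b ∸ a)) (m≤m+n _ _))
  where lhs : ∀ a c → 2 * (a * a) + 2 * (a * c) ≡ 2 * (a * (a + c))
        lhs = solve-∀
        rhs : ∀ a c → 2 * (a * a) + 2 * (a * c) + c * c ≡ a * a + (a + c) * (a + c)
        rhs = solve-∀

two-mul≤sq+sq : ∀ a b → 2 * (a * b) ≤ a * a + b * b
two-mul≤sq+sq a b with ≤-total a b
... | inj₁ a≤b = two-mul≤sq+sq-ordered a≤b
... | inj₂ b≤a = subst₂ _≤_ (cong (2 *_) (*-comm b a)) (+-comm (b * b) (a * a)) (two-mul≤sq+sq-ordered b≤a)

-- Cauchy–Schwarz for weighted sums: (Σ w·f)² ≤ (Σ w)·(Σ w·f²).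
-- Expand both sides as double sums and compare termwise using 2ab ≤ a² + b².
cauchy-schwarz : ∀ {I : Set} {σ : (I → ℕ) → ℕ} → IsSum σ → ∀ (w f : I → ℕ) →
                 σ (λ x → w x * f x) * σ (λ x → w x * f x) ≤ σ w * σ (λ x → w x * (f x * f x))
cauchy-schwarz {σ = σ} Σσ w f = *-cancelˡ-≤ 2 doubled
  where
  a g : _ → ℕ
  a x = w x * f x
  g x = w x * (f x * f x)

  termwise : ∀ x y → 2 * (a x * a y) ≤ g x * w y + w x * g y
  termwise x y = subst₂ _≤_ (lhs (w x) (w y) (f x) (f y)) (rhs (w x) (w y) (f x) (f y))
                            (*-monoʳ-≤ (w x * w y) (two-mul≤sq+sq (f x) (f y)))
    where lhs : ∀ p q r s → (p * q) * (2 * (r * s)) ≡ 2 * ((p * r) * (q * s))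
          lhs = solve-∀
          rhs : ∀ p q r s → (p * q) * (r * r + s * s) ≡ (p * (r * r)) * q + p * (q * (s * s))
          rhs = solve-∀

  doubled : 2 * (σ a * σ a) ≤ 2 * (σ w * σ g)
  doubled = begin
    2 * (σ a * σ a)                              ≡⟨ cong (2 *_) (σ-product Σσ Σσ a a) ⟩
    2 * σ (λ x → σ (λ y → a x * a y))            ≡⟨ σ-*ˡ Σσ 2 _ ⟨
    σ (λ x → 2 * σ (λ y → a x * a y))            ≡⟨ σ-cong Σσ (λ x → sym (σ-*ˡ Σσ 2 _)) ⟩
    σ (λ x → σ (λ y → 2 * (a x * a y)))          ≤⟨ σ-mono Σσ (λ x → σ-mono Σσ (termwise x)) ⟩
    σ (λ x → σ (λ y → g x * w y + w x * g y))    ≡⟨ σ-cong Σσ (λ x → σ-+ Σσ _ _) ⟩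
    σ (λ x → σ (λ y → g x * w y) + σ (λ y → w x * g y))
                                                 ≡⟨ σ-+ Σσ _ _ ⟩
    σ (λ x → σ (λ y → g x * w y)) + σ (λ x → σ (λ y → w x * g y))
                                                 ≡⟨ cong₂ _+_ (σ-product Σσ Σσ g w) (σ-product Σσ Σσ w g) ⟨
    σ g * σ w + σ w * σ g                        ≡⟨ cong (_+ σ w * σ g) (*-comm (σ g) (σ w)) ⟩
    σ w * σ g + σ w * σ g                        ≡⟨ cong (σ w * σ g +_) (+-identityʳ _) ⟨
    2 * (σ w * σ g)                              ∎
    where open ≤-Reasoning

hasSize : ∀ {n} → ℕ → Subset n → ℕ
hasSize k S = ind ⌊ ∣ S ∣ ≟ k ⌋

mem : ∀ {n} → Subset n → Fin n → ℕ
mem S i = ind (lookup S i)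

-- Adding an element raises the size by one (hasSize k (outside ∷ S) and
-- hasSize 0 (inside ∷ S) = 0 already hold by computation).
hasSize-inside : ∀ {n} k (S : Subset n) → hasSize (suc k) (inside ∷ S) ≡ hasSize k S
hasSize-inside k S with suc ∣ S ∣ ≟ suc k | ∣ S ∣ ≟ k
... | yes _  | yes _  = refl
... | no _   | no _   = refl
... | yes eq | no ne  = ⊥-elim (ne (suc-injective eq))
... | no ne  | yes eq = ⊥-elim (ne (cong suc eq))

sumSub-zero : ∀ n (f : Subset n → ℕ) → (∀ S → f S ≡ 0) → sumSub n f ≡ 0
sumSub-zero n f f≡0 = trans (σ-cong (sumSub-isSum n) f≡0) (σ-0 (sumSub-isSum n))

-- Pascal's rule, in the order "subsets avoiding the new element first".
pascal : ∀ n k → n choose suc k + n choose k ≡ suc n choose suc k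
pascal n k = trans (+-comm (n choose suc k) (n choose k)) (nCk+nC[k+1]≡[n+1]C[k+1] n k)

count-subsets : ∀ n k → sumSub n (hasSize k) ≡ n choose k
count-subsets zero    zero    = refl
count-subsets zero    (suc k) = refl
count-subsets (suc n) zero    = cong₂ _+_ (count-subsets n zero) (sumSub-zero n _ (λ _ → refl))
count-subsets (suc n) (suc k) =
  trans (cong₂ _+_ (count-subsets n (suc k))
                   (trans (σ-cong (sumSub-isSum n) (hasSize-inside k)) (count-subsets n k)))
        (pascal n k)

-- through n k = C(n, k − 1): the number of k-subsets of an (n+1)-set
-- containing a given element.
through : ℕ → ℕ → ℕ
through n zero    = 0
through n (suc k) = n choose k

count-through : ∀ n k (i : Fin (suc n)) → sumSub (suc n) (λ S → hasSize k S * mem S i) ≡ through n k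
count-through n zero zero =
  cong₂ _+_ (sumSub-zero n _ (λ S → *-zeroʳ (hasSize 0 S))) (sumSub-zero n _ (λ S → refl))
count-through n (suc k) zero =
  cong₂ _+_ (sumSub-zero n _ (λ S → *-zeroʳ (hasSize (suc k) S)))
            (trans (σ-cong (sumSub-isSum n) (λ S → trans (*-identityʳ _) (hasSize-inside k S)))
                   (count-subsets n k))
count-through (suc n) zero (suc i) =
  cong₂ _+_ (count-through n zero i) (sumSub-zero (suc n) _ (λ S → refl))
count-through (suc n) (suc k) (suc i) =
  trans (cong₂ _+_ (count-through n (suc k) i)
                   (trans (σ-cong (sumSub-isSum (suc n)) (λ S → cong (_* mem S i) (hasSize-inside k S)))
                          (count-through n k i)))
        (step k)
  where step : ∀ k → through n (suc k) + through n k ≡ through (suc n) (suc k)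
        step zero    = +-identityʳ (n choose 0)
        step (suc k) = pascal n k

-- through₂ n k = C(n, k − 2): the number of k-subsets of an (n+2)-set
-- containing two given distinct elements.
through₂ : ℕ → ℕ → ℕ
through₂ n zero    = 0
through₂ n (suc k) = through n k

count-through₂ : ∀ n k (i j : Fin (suc (suc n))) → ¬ i ≡ j →
                 sumSub (suc (suc n)) (λ S → hasSize k S * mem S i * mem S j) ≡ through₂ n k
count-through₂ n k zero zero i≢j = ⊥-elim (i≢j refl)
count-through₂ n zero zero (suc j) _ =
  cong₂ _+_ (sumSub-zero (suc n) _ (λ S → cong (_* mem S j) (*-zeroʳ (hasSize 0 S))))
            (sumSub-zero (suc n) _ (λ S → refl))
count-through₂ n (suc k) zero (suc j) _ =
  cong₂ _+_ (sumSub-zero (suc n) _ (λ S → cong (_* mem S j) (*-zeroʳ (hasSize (suc k) S))))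
            (trans (σ-cong (sumSub-isSum (suc n))
                      (λ S → cong (_* mem S j) (trans (*-identityʳ _) (hasSize-inside k S))))
                   (count-through n k j))
count-through₂ n zero (suc i) zero _ =
  cong₂ _+_ (sumSub-zero (suc n) _ (λ S → *-zeroʳ (hasSize 0 S * mem S i)))
            (sumSub-zero (suc n) _ (λ S → refl))
count-through₂ n (suc k) (suc i) zero _ =
  cong₂ _+_ (sumSub-zero (suc n) _ (λ S → *-zeroʳ (hasSize (suc k) S * mem S i)))
            (trans (σ-cong (sumSub-isSum (suc n))
                      (λ S → trans (*-identityʳ _) (cong (_* mem S i) (hasSize-inside k S))))
                   (count-through n k i))
count-through₂ zero k (suc zero) (suc zero) i≢j = ⊥-elim (i≢j refl)
count-through₂ (suc n) zero (suc i) (suc j) i≢j =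
  cong₂ _+_ (count-through₂ n zero i j (i≢j ∘′ cong suc)) (sumSub-zero (suc (suc n)) _ (λ S → refl))
count-through₂ (suc n) (suc k) (suc i) (suc j) i≢j =
  trans (cong₂ _+_ (count-through₂ n (suc k) i j (i≢j ∘′ cong suc))
                   (trans (σ-cong (sumSub-isSum (suc (suc n)))
                             (λ S → cong (λ z → z * mem S i * mem S j) (hasSize-inside k S)))
                          (count-through₂ n k i j (i≢j ∘′ cong suc))))
        (step k)
  where
  step : ∀ k → through₂ n (suc k) + through₂ n k ≡ through₂ (suc n) (suc k)
  step zero          = refl
  step (suc zero)    = +-identityʳ (n choose 0)
  step (suc (suc k)) = pascal n k

absorption : ∀ n k → k * (n choose k) ≡ n * through (pred n) k
absorption n       zero    = sym (*-zeroʳ n)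
absorption zero    (suc k) = *-zeroʳ (suc k)
absorption (suc n) (suc k) = absorption-suc n k
  where
  absorption-suc : ∀ n k → suc k * (suc n choose suc k) ≡ suc n * (n choose k)
  absorption-suc zero zero = refl
  absorption-suc zero (suc k) =
    trans (cong (suc (suc k) *_) (k>n⇒nCk≡0 {1} {suc (suc k)} (s≤s (s≤s z≤n))))
          (trans (*-zeroʳ (suc (suc k))) (sym (cong (1 *_) (k>n⇒nCk≡0 {0} {suc k} (s≤s z≤n)))))
  absorption-suc (suc n) zero = trans (*-identityˡ _) (trans (nC1≡n (suc (suc n))) (sym (*-identityʳ _)))
  absorption-suc (suc n) (suc k) = begin
    suc (suc k) * (suc (suc n) choose suc (suc k)) ≡⟨ cong (suc (suc k) *_) (pascal (suc n) (suc k)) ⟨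
    suc (suc k) * (A + B)                     ≡⟨ distribute k A B ⟩
    (suc k * B + B) + suc (suc k) * A         ≡⟨ cong₂ _+_ (cong (_+ B) (absorption-suc n k))
                                                           (absorption-suc n (suc k)) ⟩
    (suc n * (n choose k) + B) + suc n * (n choose suc k) ≡⟨ collect n (n choose k) B (n choose suc k) ⟩
    suc n * ((n choose suc k) + (n choose k)) + B       ≡⟨ cong (λ z → suc n * z + B) (pascal n k) ⟩
    suc n * B + B                             ≡⟨ +-comm (suc n * B) B ⟩
    suc (suc n) * B                           ∎
    where
    open ≡-Reasoning
    A = suc n choose suc (suc k)
    B = suc n choose suc k
    distribute : ∀ k a b → suc (suc k) * (a + b) ≡ (suc k * b + b) + suc (suc k) * a
    distribute = solve-∀
    collect : ∀ n x b y → (suc n * x + b) + suc n * y ≡ suc n * (y + x) + b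
    collect = solve-∀

-- C(n,k)·C(n−2,k−2) ≤ C(n−1,k−1)²: for a uniformly random k-set, containing
-- two distinct given elements is at most as likely as containing each of them
-- independently.
pair-inequality : ∀ m k → (suc (suc m) choose k) * through₂ m k ≤ through (suc m) k * through (suc m) k
pair-inequality m zero       = ≤-reflexive (*-zeroʳ (suc (suc m) choose 0))
pair-inequality m (suc zero) = ≤-trans (≤-reflexive (*-zeroʳ (suc (suc m) choose 1))) z≤n
pair-inequality m (suc (suc k)) with k ≤? m
... | no k≰m = ≤-trans (≤-reflexive (trans (cong (X *_) (k>n⇒nCk≡0 (≰⇒> k≰m))) (*-zeroʳ X))) z≤n
  where X = suc (suc m) choose suc (suc k)
... | yes k≤m = *-cancelˡ-≤ (suc (suc k) * suc m) (begin
    (suc (suc k) * suc m) * (X * Z) ≡⟨ regroup (suc (suc k)) (suc m) X Z ⟩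
    (suc (suc k) * X) * (suc m * Z) ≡⟨ cong₂ _*_ (absorption (suc (suc m)) (suc (suc k)))
                                                 (sym (absorption (suc m) (suc k))) ⟩
    (suc (suc m) * Y) * (suc k * Y) ≡⟨ regroup′ (suc (suc m)) Y (suc k) ⟩
    (suc (suc m) * suc k) * (Y * Y) ≤⟨ *-monoˡ-≤ (Y * Y) coefficients ⟩
    (suc (suc k) * suc m) * (Y * Y) ∎)
  where
  open ≤-Reasoning
  X = suc (suc m) choose suc (suc k)
  Y = suc m choose suc k
  Z = m choose k
  regroup : ∀ a b x z → (a * b) * (x * z) ≡ (a * x) * (b * z)
  regroup = solve-∀
  regroup′ : ∀ a y b → (a * y) * (b * y) ≡ (a * b) * (y * y)
  regroup′ = solve-∀
  -- (m+2)(k+1) ≤ (k+2)(m+1) since the difference is m − k ≥ 0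
  coefficients : suc (suc m) * suc k ≤ suc (suc k) * suc m
  coefficients = subst (λ m → suc (suc m) * suc k ≤ suc (suc k) * suc m) (m+[n∸m]≡n k≤m)
                   (subst₂ _≤_ (lhs k (m ∸ k)) (rhs k (m ∸ k)) (m≤m+n _ (m ∸ k)))
    where lhs : ∀ k c → suc (suc k) * suc k + suc k * c ≡ suc (suc (k + c)) * suc k
          lhs = solve-∀
          rhs : ∀ k c → suc (suc k) * suc k + suc k * c + c ≡ suc (suc k) * suc (k + c)
          rhs = solve-∀

-- Kronecker delta on Fin n (via 'does', which computes under suc).
δ : ∀ {n} → Fin n → Fin n → ℕ
δ i j = ind (does (i FinP.≟ j))

sumFin-δ : ∀ n (x : Fin n) (f : Fin n → ℕ) → sumFin n (λ j → δ x j * f j) ≡ f x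
sumFin-δ (suc n) zero    f = trans (cong₂ _+_ (+-identityʳ (f zero)) (σ-0 (sumFin-isSum n)))
                                   (+-identityʳ (f zero))
sumFin-δ (suc n) (suc x) f = sumFin-δ n x (λ j → f (suc j))

-- Second-moment input for random k-subsets of an (m+1)-set: with
-- K = C(m, k−1) of them through each point, C(m+1,k)·#{S ∋ i, j} ≤ K² + [i = j]·C(m+1,k)·K.
pair-count-bound : ∀ m k (i j : Fin (suc m)) →
  (suc m choose k) * sumSub (suc m) (λ S → hasSize k S * mem S i * mem S j)
    ≤ through m k * through m k + δ i j * ((suc m choose k) * through m k)
pair-count-bound m k i j with i FinP.≟ j
... | yes refl = begin
  (suc m choose k) * sumSub (suc m) (λ S → hasSize k S * mem S i * mem S i)
    ≡⟨ cong ((suc m choose k) *_) (trans (σ-cong (sumSub-isSum (suc m)) mem-idempotent) (count-through m k i)) ⟩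
  (suc m choose k) * through m k
    ≤⟨ m≤n+m _ (through m k * through m k) ⟩
  through m k * through m k + (suc m choose k) * through m k
    ≡⟨ cong (through m k * through m k +_) (*-identityˡ _) ⟨
  through m k * through m k + 1 * ((suc m choose k) * through m k) ∎
  where
  open ≤-Reasoning
  ind-idempotent : ∀ b → ind b * ind b ≡ ind b
  ind-idempotent true  = refl
  ind-idempotent false = refl
  mem-idempotent : ∀ S → hasSize k S * mem S i * mem S i ≡ hasSize k S * mem S i
  mem-idempotent S = trans (*-assoc (hasSize k S) (mem S i) (mem S i))
                           (cong (hasSize k S *_) (ind-idempotent (lookup S i)))
pair-count-bound zero    k zero zero | no i≢i = ⊥-elim (i≢i refl)
pair-count-bound (suc m) k i j | no i≢j = begin
  (suc (suc m) choose k) * sumSub (suc (suc m)) (λ S → hasSize k S * mem S i * mem S j)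
    ≡⟨ cong ((suc (suc m) choose k) *_) (count-through₂ m k i j i≢j) ⟩
  (suc (suc m) choose k) * through₂ m k
    ≤⟨ pair-inequality m k ⟩
  through (suc m) k * through (suc m) k
    ≡⟨ +-identityʳ _ ⟨
  through (suc m) k * through (suc m) k + 0 * ((suc (suc m) choose k) * through (suc m) k) ∎
  where open ≤-Reasoning

-- An edge (i, t) is clause i together with the slot t of one of its
-- variables; by DistinctVars these are exactly the 3M question pairs of G_φ.
module Setting {N M : ℕ} (φ : CNF N M) where

  Edge : Set
  Edge = Fin M × Fin 3

  ΣE : (Edge → ℕ) → ℕ
  ΣE f = sumFin M (λ i → sumFin 3 (λ t → f (i , t)))

  ΣE-isSum : IsSum ΣE
  ΣE-isSum = σ-nested (sumFin-isSum M) (sumFin-isSum 3)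

  clause : Edge → Fin M
  clause = proj₁

  variableOf : Edge → Fin N
  variableOf (i , t) = var φ i t

  acc : Edge → ClauseAssignment → Bool → ℕ
  acc (i , t) α β = ind (accepts φ i t α β)

  -- the number of edges accepted by a strategy pair; valueG is this over 3M
  -- (spelled out as in valueG, so that the two agree after one unfolding)
  accepted : Strat₁ M → Strat₂ N → ℕ
  accepted a b = sumFin M (λ i → sumFin 3 (λ t → ind (accepts φ i t (a i) (b (var φ i t)))))

  group-by-variable : ∀ (F : Edge → Fin N → ℕ) →
                      ΣE (λ e → F e (variableOf e)) ≡ sumFin N (λ j → ΣE (λ e → δ (variableOf e) j * F e j))
  group-by-variable F =
    trans (σ-cong ΣE-isSum (λ e → sym (sumFin-δ N (variableOf e) (F e))))
          (sym (sumFin-swap ΣE-isSum N (λ j e → δ (variableOf e) j * F e j)))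

  ΣEE : (Edge × Edge → ℕ) → ℕ
  ΣEE f = ΣE (λ e → ΣE (λ e′ → f (e , e′)))

  ΣEE-isSum : IsSum ΣEE
  ΣEE-isSum = σ-nested ΣE-isSum ΣE-isSum

  sameClause : ℕ
  sameClause = ΣEE (λ (e , e′) → δ (clause e) (clause e′))

  sameVariable : ℕ
  sameVariable = ΣEE (λ (e , e′) → δ (variableOf e) (variableOf e′))

  Pair : Set
  Pair = Subset M × Subset N

  ΣP : (Pair → ℕ) → ℕ
  ΣP f = sumSub M (λ S → sumSub N (λ T → f (S , T)))

  ΣP-isSum : IsSum ΣP
  ΣP-isSum = σ-nested (sumSub-isSum M) (sumSub-isSum N)

  ΣP-ΣE-swap : ∀ (F : Pair → Edge → ℕ) → ΣP (λ p → ΣE (F p)) ≡ ΣE (λ e → ΣP (λ p → F p e))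
  ΣP-ΣE-swap F = trans (σ-cong (sumSub-isSum M) (λ S → sumSub-swap ΣE-isSum N (λ T → F (S , T))))
                       (sumSub-swap ΣE-isSum M (λ S e → sumSub N (λ T → F (S , T) e)))

  legal : ℕ → ℕ → Pair → ℕ
  legal k ℓ (S , T) = hasSize k S * hasSize ℓ T

  covered : Pair → Edge → ℕ
  covered (S , T) e = mem S (clause e) * mem T (variableOf e)

  X : Pair → ℕ
  X p = ΣE (covered p)

  ΣP-factor : ∀ k ℓ (f : Subset M → ℕ) (g : Subset N → ℕ) →
              ΣP (λ p → legal k ℓ p * (f (proj₁ p) * g (proj₂ p)))
                ≡ sumSub M (λ S → hasSize k S * f S) * sumSub N (λ T → hasSize ℓ T * g T)
  ΣP-factor k ℓ f g =
    trans (σ-cong ΣP-isSum (λ (S , T) → interchange (hasSize k S) (hasSize ℓ T) (f S) (g T)))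
          (sym (σ-product (sumSub-isSum M) (sumSub-isSum N) (λ S → hasSize k S * f S) (λ T → hasSize ℓ T * g T)))
    where interchange : ∀ a b c d → a * b * (c * d) ≡ a * c * (b * d)
          interchange = solve-∀

better : ∀ {X : Set} → (X → ℕ) → X → X → X
better f x y with f x ≤? f y
... | yes _ = y
... | no _  = x

better-left : ∀ {X : Set} (f : X → ℕ) (x y : X) → f x ≤ f (better f x y)
better-left f x y with f x ≤? f y
... | yes fx≤fy = fx≤fy
... | no _      = ≤-refl

better-right : ∀ {X : Set} (f : X → ℕ) (x y : X) → f y ≤ f (better f x y)
better-right f x y with f x ≤? f y
... | yes _     = ≤-refl
... | no fx≰fy  = <⇒≤ (≰⇒> fx≰fy)

argmaxBool : (Bool → ℕ) → Bool
argmaxBool f = better f false true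

argmaxBool-max : ∀ (f : Bool → ℕ) β → f β ≤ f (argmaxBool f)
argmaxBool-max f false = better-left f false true
argmaxBool-max f true  = better-right f false true

argmaxSub : ∀ n → (Subset n → ℕ) → Subset n
argmaxSub zero    f = []
argmaxSub (suc n) f = better f (outside ∷ argmaxSub n (λ s → f (outside ∷ s)))
                               (inside ∷ argmaxSub n (λ s → f (inside ∷ s)))

argmaxSub-max : ∀ n (f : Subset n → ℕ) S → f S ≤ f (argmaxSub n f)
argmaxSub-max zero    f []            = ≤-refl
argmaxSub-max (suc n) f (outside ∷ S) = ≤-trans (argmaxSub-max n (λ s → f (outside ∷ s)) S) (better-left f _ _)
argmaxSub-max (suc n) f (inside ∷ S)  = ≤-trans (argmaxSub-max n (λ s → f (inside ∷ s)) S) (better-right f _ _)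

weighted-sum≤max : ∀ {I Y : Set} {σ : (I → ℕ) → ℕ} → IsSum σ →
                   ∀ (c : I → ℕ) (F : Y → ℕ) (choice : I → Y) (y* : Y) → (∀ y → F y ≤ F y*) →
                   σ (λ x → c x * F (choice x)) ≤ σ c * F y*
weighted-sum≤max Σσ c F choice y* max =
  ≤-trans (σ-mono Σσ (λ x → *-monoʳ-≤ (c x) (max (choice x)))) (≤-reflexive (σ-*ʳ Σσ (F y*) c))

sumSub-pull : ∀ {I : Set} {σ : (I → ℕ) → ℕ} → IsSum σ → ∀ n (d : I → ℕ) (c : Subset n → ℕ) (g : I → Subset n → ℕ) →
              σ (λ x → d x * sumSub n (λ T → c T * g x T)) ≡ sumSub n (λ T → c T * σ (λ x → d x * g x T))
sumSub-pull {σ = σ} Σσ n d c g = begin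
  σ (λ x → d x * sumSub n (λ T → c T * g x T))      ≡⟨ σ-cong Σσ (λ x → sym (σ-*ˡ (sumSub-isSum n) (d x) _)) ⟩
  σ (λ x → sumSub n (λ T → d x * (c T * g x T)))    ≡⟨ sumSub-swap Σσ n (λ T x → d x * (c T * g x T)) ⟨
  sumSub n (λ T → σ (λ x → d x * (c T * g x T)))    ≡⟨ σ-cong (sumSub-isSum n) (λ T → σ-cong Σσ (λ x → swap-front (d x) (c T) (g x T))) ⟩
  sumSub n (λ T → σ (λ x → c T * (d x * g x T)))    ≡⟨ σ-cong (sumSub-isSum n) (λ T → σ-*ˡ Σσ (c T) _) ⟩
  sumSub n (λ T → c T * σ (λ x → d x * g x T))      ∎
  where open ≡-Reasoning
        swap-front : ∀ a b c → a * (b * c) ≡ b * (a * c)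
        swap-front = solve-∀

-- From strategies (A, B) for the repeated game we
-- extract strategies (a, b) for G_φ: prover 2 answers variable j with the bit
-- accepted most often against the answers A S offers on edges at j, and
-- prover 1 then answers clause i as the best A S does against b.  Only the
-- regularity of the set system (every point lies in K resp. L legal sets)
-- is used.
module BestResponse {N M : ℕ} (φ : CNF N M) (k ℓ : ℕ) (A : RepStrat₁ M) (B : RepStrat₂ N)
                    (K L : ℕ)
                    (count-K : ∀ i → sumSub M (λ S → hasSize k S * mem S i) ≡ K)
                    (count-L : ∀ j → sumSub N (λ T → hasSize ℓ T * mem T j) ≡ L) where
  open Setting φ

  checkedAccept : Pair → Edge → ℕ
  checkedAccept (S , T) e = covered (S , T) e * acc e (A S (clause e)) (B T (variableOf e))

  W : ℕ
  W = ΣP (λ p → legal k ℓ p * ΣE (checkedAccept p))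

  gain : Edge → Bool → ℕ
  gain e β = sumSub M (λ S → hasSize k S * mem S (clause e) * acc e (A S (clause e)) β)

  variableGain : Fin N → Bool → ℕ
  variableGain j β = ΣE (λ e → δ (variableOf e) j * gain e β)

  b : Strat₂ N
  b j = argmaxBool (variableGain j)

  clauseGain : Fin M → Subset M → ℕ
  clauseGain i S = sumFin 3 (λ t → acc (i , t) (A S i) (b (var φ i t)))

  a : Strat₁ M
  a i = A (argmaxSub M (clauseGain i)) i

  W-by-edge : W ≡ ΣE (λ e → sumSub N (λ T → hasSize ℓ T * mem T (variableOf e) * gain e (B T (variableOf e))))
  W-by-edge = begin
    W ≡⟨ σ-cong ΣP-isSum (λ p → sym (σ-*ˡ ΣE-isSum (legal k ℓ p) (checkedAccept p))) ⟩
    ΣP (λ p → ΣE (λ e → legal k ℓ p * checkedAccept p e))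
      ≡⟨ ΣP-ΣE-swap (λ p e → legal k ℓ p * checkedAccept p e) ⟩
    ΣE (λ e → ΣP (λ p → legal k ℓ p * checkedAccept p e))
      ≡⟨ σ-cong ΣE-isSum at-edge ⟩
    ΣE (λ e → sumSub N (λ T → hasSize ℓ T * mem T (variableOf e) * gain e (B T (variableOf e)))) ∎
    where
    open ≡-Reasoning
    regroup : ∀ s t x y z → s * t * (x * y * z) ≡ t * y * (s * x * z)
    regroup = solve-∀
    at-edge : ∀ e → ΣP (λ p → legal k ℓ p * checkedAccept p e)
                      ≡ sumSub N (λ T → hasSize ℓ T * mem T (variableOf e) * gain e (B T (variableOf e)))
    at-edge e@(i , t) = begin
      sumSub M (λ S → sumSub N (λ T → hasSize k S * hasSize ℓ T * (mem S i * mem T j * acc e (A S i) (B T j))))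
        ≡⟨ σ-cong ΣP-isSum (λ (S , T) → regroup (hasSize k S) (hasSize ℓ T) (mem S i) (mem T j) _) ⟩
      sumSub M (λ S → sumSub N (λ T → hasSize ℓ T * mem T j * (hasSize k S * mem S i * acc e (A S i) (B T j))))
        ≡⟨ sumSub-swap (sumSub-isSum N) M _ ⟩
      sumSub N (λ T → sumSub M (λ S → hasSize ℓ T * mem T j * (hasSize k S * mem S i * acc e (A S i) (B T j))))
        ≡⟨ σ-cong (sumSub-isSum N) (λ T → σ-*ˡ (sumSub-isSum M) (hasSize ℓ T * mem T j) _) ⟩
      sumSub N (λ T → hasSize ℓ T * mem T j * gain e (B T j)) ∎
      where j = var φ i t

  -- Prover 2's bit b j is at least as good as any B T j.
  W≤b : W ≤ L * ΣE (λ e → gain e (b (variableOf e)))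
  W≤b = begin
    W ≡⟨ W-by-edge ⟩
    ΣE (λ e → sumSub N (λ T → hasSize ℓ T * mem T (variableOf e) * gain e (B T (variableOf e))))
      ≡⟨ group-by-variable (λ e j → sumSub N (λ T → hasSize ℓ T * mem T j * gain e (B T j))) ⟩
    sumFin N (λ j → ΣE (λ e → δ (variableOf e) j * sumSub N (λ T → hasSize ℓ T * mem T j * gain e (B T j))))
      ≡⟨ σ-cong (sumFin-isSum N) (λ j → sumSub-pull ΣE-isSum N (λ e → δ (variableOf e) j) (λ T → hasSize ℓ T * mem T j) (λ e T → gain e (B T j))) ⟩
    sumFin N (λ j → sumSub N (λ T → hasSize ℓ T * mem T j * variableGain j (B T j)))
      ≤⟨ σ-mono (sumFin-isSum N) (λ j → weighted-sum≤max (sumSub-isSum N) (λ T → hasSize ℓ T * mem T j)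
                                             (variableGain j) (λ T → B T j) (b j) (argmaxBool-max (variableGain j))) ⟩
    sumFin N (λ j → sumSub N (λ T → hasSize ℓ T * mem T j) * variableGain j (b j))
      ≡⟨ σ-cong (sumFin-isSum N) (λ j → cong (_* variableGain j (b j)) (count-L j)) ⟩
    sumFin N (λ j → L * variableGain j (b j))
      ≡⟨ σ-*ˡ (sumFin-isSum N) L _ ⟩
    L * sumFin N (λ j → variableGain j (b j))
      ≡⟨ cong (L *_) (group-by-variable (λ e j → gain e (b j))) ⟨
    L * ΣE (λ e → gain e (b (variableOf e))) ∎
    where open ≤-Reasoning

  -- Prover 1's answer a i is at least as good as any A S i.
  gain≤a : ΣE (λ e → gain e (b (variableOf e))) ≤ K * accepted a b
  gain≤a = begin
    ΣE (λ e → gain e (b (variableOf e)))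
      ≡⟨ σ-cong (sumFin-isSum M) (λ i → sumFin-swap (sumSub-isSum M) 3
                                          (λ t S → hasSize k S * mem S i * acc (i , t) (A S i) (b (var φ i t)))) ⟩
    sumFin M (λ i → sumSub M (λ S → sumFin 3 (λ t → hasSize k S * mem S i * acc (i , t) (A S i) (b (var φ i t)))))
      ≡⟨ σ-cong (sumFin-isSum M) (λ i → σ-cong (sumSub-isSum M) (λ S → σ-*ˡ (sumFin-isSum 3) (hasSize k S * mem S i)
                                                 (λ t → acc (i , t) (A S i) (b (var φ i t))))) ⟩
    sumFin M (λ i → sumSub M (λ S → hasSize k S * mem S i * clauseGain i S))
      ≤⟨ σ-mono (sumFin-isSum M) (λ i → weighted-sum≤max (sumSub-isSum M) (λ S → hasSize k S * mem S i)
                                             (clauseGain i) (λ S → S) _ (argmaxSub-max M (clauseGain i))) ⟩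
    sumFin M (λ i → sumSub M (λ S → hasSize k S * mem S i) * clauseGain i (argmaxSub M (clauseGain i)))
      ≡⟨ σ-cong (sumFin-isSum M) (λ i → cong (_* clauseGain i (argmaxSub M (clauseGain i))) (count-K i)) ⟩
    sumFin M (λ i → K * clauseGain i (argmaxSub M (clauseGain i)))
      ≡⟨ σ-*ˡ (sumFin-isSum M) K _ ⟩
    K * accepted a b ∎
    where open ≤-Reasoning

  best-response : W ≤ L * (K * accepted a b)
  best-response = ≤-trans W≤b (*-monoʳ-≤ L gain≤a)

expand-indicators : ∀ (p q : Bool) x y a b →
  (x + ind p * a) * (y + ind q * b) ≤ x * y + ind q * (x * b) + ind p * (a * y + a * b)
expand-indicators true  true  x y a b = ≤-reflexive (both x y a b)
  where both : ∀ x y a b → (x + 1 * a) * (y + 1 * b) ≡ x * y + 1 * (x * b) + 1 * (a * y + a * b)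
        both = solve-∀
expand-indicators true  false x y a b = subst₂ _≤_ (sym (lhs x y a)) (sym (rhs x y a b)) (m≤m+n _ (a * b))
  where lhs : ∀ x y a → (x + 1 * a) * (y + 0 * b) ≡ x * y + a * y
        lhs = solve-∀
        rhs : ∀ x y a b → x * y + 0 * (x * b) + 1 * (a * y + a * b) ≡ x * y + a * y + a * b
        rhs = solve-∀
expand-indicators false true  x y a b = ≤-reflexive (right x y a b)
  where right : ∀ x y a b → (x + 0 * a) * (y + 1 * b) ≡ x * y + 1 * (x * b) + 0 * (a * y + a * b)
        right = solve-∀
expand-indicators false false x y a b = ≤-reflexive (neither x y a b)
  where neither : ∀ x y a b → (x + 0 * a) * (y + 0 * b) ≡ x * y + 0 * (x * b) + 0 * (a * y + a * b)
        neither = solve-∀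

-- Over legal pairs, X has total m = 3M·K·L, and its
-- second moment exceeds m²/n only by collision terms: pairs of edges sharing
-- a variable or a clause.  Only the one- and two-point inclusion counts of the
-- random sets enter.
module Moments {N M : ℕ} (φ : CNF N M) (k ℓ nS nT K L : ℕ)
               (count-K : ∀ i → sumSub M (λ S → hasSize k S * mem S i) ≡ K)
               (count-L : ∀ j → sumSub N (λ T → hasSize ℓ T * mem T j) ≡ L)
               (pairs-S : ∀ i i′ → nS * sumSub M (λ S → hasSize k S * mem S i * mem S i′) ≤ K * K + δ i i′ * (nS * K))
               (pairs-T : ∀ j j′ → nT * sumSub N (λ T → hasSize ℓ T * mem T j * mem T j′) ≤ L * L + δ j j′ * (nT * L))
               where
  open Setting φ

  m : ℕ
  m = ΣE (λ _ → K * L)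

  mean : ΣP (λ p → legal k ℓ p * X p) ≡ m
  mean = begin
    ΣP (λ p → legal k ℓ p * X p)                ≡⟨ σ-cong ΣP-isSum (λ p → sym (σ-*ˡ ΣE-isSum (legal k ℓ p) (covered p))) ⟩
    ΣP (λ p → ΣE (λ e → legal k ℓ p * covered p e)) ≡⟨ ΣP-ΣE-swap (λ p e → legal k ℓ p * covered p e) ⟩
    ΣE (λ e → ΣP (λ p → legal k ℓ p * covered p e)) ≡⟨ σ-cong ΣE-isSum at-edge ⟩
    m                                           ∎
    where
    open ≡-Reasoning
    at-edge : ∀ e → ΣP (λ p → legal k ℓ p * covered p e) ≡ K * L
    at-edge e = trans (ΣP-factor k ℓ (λ S → mem S (clause e)) (λ T → mem T (variableOf e)))
                      (cong₂ _*_ (count-K (clause e)) (count-L (variableOf e)))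

  pairsS : Fin M → Fin M → ℕ
  pairsS i i′ = sumSub M (λ S → hasSize k S * mem S i * mem S i′)

  pairsT : Fin N → Fin N → ℕ
  pairsT j j′ = sumSub N (λ T → hasSize ℓ T * mem T j * mem T j′)

  secondMoment : ℕ
  secondMoment = ΣP (λ p → legal k ℓ p * (X p * X p))

  secondMoment-by-edges : secondMoment ≡ ΣEE (λ (e , e′) → pairsS (clause e) (clause e′) * pairsT (variableOf e) (variableOf e′))
  secondMoment-by-edges = begin
    ΣP (λ p → legal k ℓ p * (X p * X p))
      ≡⟨ σ-cong ΣP-isSum (λ p → cong (legal k ℓ p *_) (σ-product ΣE-isSum ΣE-isSum (covered p) (covered p))) ⟩
    ΣP (λ p → legal k ℓ p * ΣEE (λ (e , e′) → covered p e * covered p e′))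
      ≡⟨ σ-cong ΣP-isSum (λ p → sym (σ-*ˡ ΣEE-isSum (legal k ℓ p) (λ (e , e′) → covered p e * covered p e′))) ⟩
    ΣP (λ p → ΣEE (λ (e , e′) → legal k ℓ p * (covered p e * covered p e′)))
      ≡⟨ ΣP-ΣEE-swap (λ p (e , e′) → legal k ℓ p * (covered p e * covered p e′)) ⟩
    ΣEE (λ (e , e′) → ΣP (λ p → legal k ℓ p * (covered p e * covered p e′)))
      ≡⟨ σ-cong ΣEE-isSum at-edges ⟩
    ΣEE (λ (e , e′) → pairsS (clause e) (clause e′) * pairsT (variableOf e) (variableOf e′)) ∎
    where
    open ≡-Reasoning
    ΣP-ΣEE-swap : ∀ (F : Pair → Edge × Edge → ℕ) → ΣP (λ p → ΣEE (F p)) ≡ ΣEE (λ ee → ΣP (λ p → F p ee))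
    ΣP-ΣEE-swap F = trans (ΣP-ΣE-swap (λ p e → ΣE (λ e′ → F p (e , e′))))
                          (σ-cong ΣE-isSum (λ e → ΣP-ΣE-swap (λ p e′ → F p (e , e′))))
    interchange : ∀ a b c d → (a * b) * (c * d) ≡ (a * c) * (b * d)
    interchange = solve-∀
    at-edges : ∀ ((e , e′) : Edge × Edge) →
               ΣP (λ p → legal k ℓ p * (covered p e * covered p e′))
                 ≡ pairsS (clause e) (clause e′) * pairsT (variableOf e) (variableOf e′)
    at-edges (e , e′) =
      trans (σ-cong ΣP-isSum (λ (S , T) → cong (legal k ℓ (S , T) *_)
                (interchange (mem S (clause e)) (mem T (variableOf e)) (mem S (clause e′)) (mem T (variableOf e′)))))
      (trans (ΣP-factor k ℓ (λ S → mem S (clause e) * mem S (clause e′)) (λ T → mem T (variableOf e) * mem T (variableOf e′)))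
             (cong₂ _*_ (σ-cong (sumSub-isSum M) (λ S → sym (*-assoc (hasSize k S) _ _)))
                        (σ-cong (sumSub-isSum N) (λ T → sym (*-assoc (hasSize ℓ T) _ _)))))

  variableWeight clauseWeight : ℕ
  variableWeight = K * K * (nT * L)
  clauseWeight   = nS * K * (L * L) + nS * K * (nT * L)

  second-moment-bound :
    nS * nT * secondMoment ≤ m * m + (variableWeight * sameVariable + clauseWeight * sameClause)
  second-moment-bound = begin
    nS * nT * secondMoment
      ≡⟨ cong (nS * nT *_) secondMoment-by-edges ⟩
    nS * nT * ΣEE (λ (e , e′) → pairsS (clause e) (clause e′) * pairsT (variableOf e) (variableOf e′))
      ≡⟨ σ-*ˡ ΣEE-isSum (nS * nT) (λ (e , e′) → pairsS (clause e) (clause e′) * pairsT (variableOf e) (variableOf e′)) ⟨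
    ΣEE (λ (e , e′) → nS * nT * (pairsS (clause e) (clause e′) * pairsT (variableOf e) (variableOf e′)))
      ≤⟨ σ-mono ΣEE-isSum (λ (e , e′) → per-pair (clause e) (clause e′) (variableOf e) (variableOf e′)) ⟩
    ΣEE (λ ee → base ee + variableCollision ee + clauseCollision ee)
      ≡⟨ σ-+ ΣEE-isSum (λ ee → base ee + variableCollision ee) clauseCollision ⟩
    ΣEE (λ ee → base ee + variableCollision ee) + ΣEE clauseCollision
      ≡⟨ cong (_+ ΣEE clauseCollision) (σ-+ ΣEE-isSum base variableCollision) ⟩
    ΣEE base + ΣEE variableCollision + ΣEE clauseCollision
      ≡⟨ cong₂ _+_ (cong₂ _+_ mean-squared (σ-*ʳ ΣEE-isSum variableWeight (λ (e , e′) → δ (variableOf e) (variableOf e′))))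
                   (σ-*ʳ ΣEE-isSum clauseWeight (λ (e , e′) → δ (clause e) (clause e′))) ⟩
    m * m + sameVariable * variableWeight + sameClause * clauseWeight
      ≡⟨ +-assoc (m * m) _ _ ⟩
    m * m + (sameVariable * variableWeight + sameClause * clauseWeight)
      ≡⟨ cong (m * m +_) (cong₂ _+_ (*-comm sameVariable _) (*-comm sameClause _)) ⟩
    m * m + (variableWeight * sameVariable + clauseWeight * sameClause) ∎
    where
    open ≤-Reasoning
    base variableCollision clauseCollision : Edge × Edge → ℕ
    base _                     = K * K * (L * L)
    variableCollision (e , e′) = δ (variableOf e) (variableOf e′) * variableWeight
    clauseCollision (e , e′)   = δ (clause e) (clause e′) * clauseWeight
    per-pair : ∀ i i′ j j′ → nS * nT * (pairsS i i′ * pairsT j j′) ≤ K * K * (L * L) + δ j j′ * variableWeight + δ i i′ * clauseWeight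
    per-pair i i′ j j′ = begin
      nS * nT * (pairsS i i′ * pairsT j j′)     ≡⟨ interchange nS nT (pairsS i i′) (pairsT j j′) ⟩
      (nS * pairsS i i′) * (nT * pairsT j j′)   ≤⟨ *-mono-≤ (pairs-S i i′) (pairs-T j j′) ⟩
      (K * K + δ i i′ * (nS * K)) * (L * L + δ j j′ * (nT * L))
        ≤⟨ expand-indicators (does (i FinP.≟ i′)) (does (j FinP.≟ j′)) (K * K) (L * L) (nS * K) (nT * L) ⟩
      K * K * (L * L) + δ j j′ * variableWeight + δ i i′ * clauseWeight ∎
      where interchange : ∀ a b c d → a * b * (c * d) ≡ (a * c) * (b * d)
            interchange = solve-∀
    mean-squared : ΣEE base ≡ m * m
    mean-squared = trans (σ-cong ΣEE-isSum (λ _ → interchange K L))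
                         (sym (σ-product ΣE-isSum ΣE-isSum (λ _ → K * L) (λ _ → K * L)))
      where interchange : ∀ a b → a * a * (b * b) ≡ a * b * (a * b)
            interchange = solve-∀

anyFin-true : ∀ n (p : Fin n → Bool) (t : Fin n) → p t ≡ true → anyFin n p ≡ true
anyFin-true (suc n) p zero    pt≡true rewrite pt≡true = refl
anyFin-true (suc n) p (suc t) pt≡true with p zero
... | true  = refl
... | false = anyFin-true n (λ i → p (suc i)) t pt≡true

δ≤occurs : ∀ {N M} (φ : CNF N M) (i : Fin M) (t : Fin 3) (j : Fin N) → δ j (var φ i t) ≤ ind (occurs φ i j)
δ≤occurs φ i t j with j FinP.≟ var φ i t
... | no _     = z≤n
... | yes refl = ≤-reflexive (sym (cong ind (anyFin-true 3 (λ t′ → ⌊ var φ i t′ FinP.≟ var φ i t ⌋) t self)))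
  where self : ⌊ var φ i t FinP.≟ var φ i t ⌋ ≡ true
        self with var φ i t FinP.≟ var φ i t
        ... | yes _  = refl
        ... | no x≢x = ⊥-elim (x≢x refl)

-- Part 3 (collisions).  Each edge shares its clause with exactly 3 edges and,
-- when φ is d-regular, its variable with at most 3d edges.
module Collisions {N M : ℕ} (φ : CNF N M) where
  open Setting φ

  same-clause-count : sameClause ≡ M * (3 * 3)
  same-clause-count = begin
    ΣE (λ (i , _) → sumFin M (λ i′ → sumFin 3 (λ _ → δ i i′)))
      ≡⟨ σ-cong ΣE-isSum (λ (i , _) → σ-cong (sumFin-isSum M) (λ i′ → trans (sumFin-const 3 (δ i i′)) (*-comm 3 (δ i i′)))) ⟩
    ΣE (λ (i , _) → sumFin M (λ i′ → δ i i′ * 3))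
      ≡⟨ σ-cong ΣE-isSum (λ (i , _) → sumFin-δ M i (λ _ → 3)) ⟩
    sumFin M (λ _ → sumFin 3 (λ _ → 3))
      ≡⟨ trans (σ-cong (sumFin-isSum M) (λ _ → sumFin-const 3 3)) (sumFin-const M (3 * 3)) ⟩
    M * (3 * 3) ∎
    where open ≡-Reasoning

  same-variable-bound : ∀ d → Regular d φ → sameVariable ≤ M * (3 * (3 * d))
  same-variable-bound d regular = begin
    ΣE (λ e → ΣE (λ e′ → δ (variableOf e) (variableOf e′)))
      ≤⟨ σ-mono ΣE-isSum (λ e → at-variable (variableOf e)) ⟩
    ΣE (λ _ → 3 * d)
      ≡⟨ trans (σ-cong (sumFin-isSum M) (λ _ → sumFin-const 3 (3 * d))) (sumFin-const M (3 * (3 * d))) ⟩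
    M * (3 * (3 * d)) ∎
    where
    open ≤-Reasoning
    at-variable : ∀ j → ΣE (λ e′ → δ j (variableOf e′)) ≤ 3 * d
    at-variable j = begin
      ΣE (λ (i , t) → δ j (var φ i t))             ≤⟨ σ-mono ΣE-isSum (λ (i , t) → δ≤occurs φ i t j) ⟩
      ΣE (λ (i , _) → ind (occurs φ i j))           ≡⟨ σ-cong (sumFin-isSum M) (λ i → sumFin-const 3 (ind (occurs φ i j))) ⟩
      sumFin M (λ i → 3 * ind (occurs φ i j))       ≡⟨ σ-*ˡ (sumFin-isSum M) 3 (λ i → ind (occurs φ i j)) ⟩
      3 * sumFin M (λ i → ind (occurs φ i j))       ≡⟨ cong (3 *_) (regular j) ⟩
      3 * d                                         ∎

ind-∧ : ∀ a b → ind (a ∧ b) ≡ ind a * ind b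
ind-∧ true  b = sym (+-identityʳ (ind b))
ind-∧ false b = refl

ind-scale : ∀ b x → ind b * x ≤ x
ind-scale true  x = ≤-reflexive (+-identityʳ x)
ind-scale false x = z≤n

allFin-bound : ∀ n (p : Fin n → Bool) (f g : Fin n → ℕ) → (∀ i → ind (p i) * f i ≤ g i) →
               ind (allFin n p) * sumFin n f ≤ sumFin n g
allFin-bound zero    p f g termwise = z≤n
allFin-bound (suc n) p f g termwise with p zero | termwise zero
... | false | _  = z≤n
... | true  | f₀≤g₀ = begin
  ind rest * (f zero + sumFin n (λ i → f (suc i)))
    ≡⟨ *-distribˡ-+ (ind rest) (f zero) _ ⟩
  ind rest * f zero + ind rest * sumFin n (λ i → f (suc i))
    ≤⟨ +-mono-≤ (≤-trans (ind-scale rest (f zero)) (≤-trans (m≤m+n (f zero) 0) f₀≤g₀))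
                (allFin-bound n (λ i → p (suc i)) (λ i → f (suc i)) (λ i → g (suc i)) (λ i → termwise (suc i))) ⟩
  g zero + sumFin n (λ i → g (suc i)) ∎
  where open ≤-Reasoning
        rest = allFin n (λ i → p (suc i))

passed-check : ∀ (s t c : Bool) → ind (not (s ∧ t) ∨ c) * (ind s * ind t) ≤ ind s * ind t * ind c
passed-check true  true  true  = ≤-refl
passed-check true  true  false = ≤-refl
passed-check true  false c     = z≤n
passed-check false t     c     = z≤n

-- m·[w·e] ≤ [w·e]·y + w·(m ∸ y): an accepted pair either has y ≥ m checked
-- edges, or contributes to the deficit m ∸ y.
accepted-or-deficit : ∀ w (e : Bool) m y → m * (w * ind e) ≤ (w * ind e) * y + w * (m ∸ y)
accepted-or-deficit w false m y = ≤-trans (≤-reflexive (trans (cong (m *_) (*-zeroʳ w)) (*-zeroʳ m))) z≤n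
accepted-or-deficit w true  m y = begin
  m * (w * 1)           ≡⟨ cong (m *_) (*-identityʳ w) ⟩
  m * w                 ≡⟨ *-comm m w ⟩
  w * m                 ≤⟨ *-monoʳ-≤ w (m≤n+m∸n m y) ⟩
  w * (y + (m ∸ y))     ≡⟨ *-distribˡ-+ w y (m ∸ y) ⟩
  w * y + w * (m ∸ y)   ≡⟨ cong (λ z → z * y + w * (m ∸ y)) (*-identityʳ w) ⟨
  w * 1 * y + w * (m ∸ y) ∎
  where open ≤-Reasoning

monus-square : ∀ m y → (m ∸ y) * (m ∸ y) + 2 * (m * y) ≤ m * m + y * y
monus-square m y with ≤-total y m
... | inj₁ y≤m = ≤-reflexive (subst (λ m → (m ∸ y) * (m ∸ y) + 2 * (m * y) ≡ m * m + y * y) (m∸n+n≡m y≤m)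
                                   (trans (cong (λ z → z * z + 2 * ((m ∸ y + y) * y)) (m+n∸n≡m (m ∸ y) y))
                                          (square-of-sum (m ∸ y) y)))
  where square-of-sum : ∀ c y → c * c + 2 * ((c + y) * y) ≡ (c + y) * (c + y) + y * y
        square-of-sum = solve-∀
... | inj₂ m≤y = subst (λ z → z * z + 2 * (m * y) ≤ m * m + y * y) (sym (m≤n⇒m∸n≡0 m≤y)) (two-mul≤sq+sq m y)

deficit-variance : ∀ {I : Set} {σ : (I → ℕ) → ℕ} → IsSum σ → ∀ (w x : I → ℕ) n m →
                   σ w ≡ n → σ (λ p → w p * x p) ≡ m →
                   σ (λ p → w p * ((m ∸ n * x p) * (m ∸ n * x p))) + n * (m * m) ≤ n * (n * σ (λ p → w p * (x p * x p)))
deficit-variance {σ = σ} Σσ w x n m Σw≡n Σwx≡m = +-cancelʳ-≤ (n * (m * m)) _ _ (begin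
  F + n * (m * m) + n * (m * m)                    ≡⟨ double F n m ⟩
  F + 2 * (m * n) * m                              ≡⟨ cong (λ z → F + 2 * (m * n) * z) Σwx≡m ⟨
  F + 2 * (m * n) * σ (λ p → w p * x p)            ≡⟨ cong (F +_) (σ-*ˡ Σσ (2 * (m * n)) _) ⟨
  F + σ (λ p → 2 * (m * n) * (w p * x p))          ≡⟨ cong (F +_) (σ-cong Σσ (λ p → regroup m n (w p) (x p))) ⟩
  F + σ (λ p → w p * (2 * (m * (n * x p))))        ≡⟨ σ-+ Σσ (λ p → w p * (deficit p * deficit p)) _ ⟨
  σ (λ p → w p * (deficit p * deficit p) + w p * (2 * (m * (n * x p))))
    ≤⟨ σ-mono Σσ (λ p → subst₂ _≤_ (*-distribˡ-+ (w p) _ _) (*-distribˡ-+ (w p) _ _)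
                                   (*-monoʳ-≤ (w p) (monus-square m (n * x p)))) ⟩
  σ (λ p → w p * (m * m) + w p * ((n * x p) * (n * x p)))
    ≡⟨ σ-+ Σσ (λ p → w p * (m * m)) _ ⟩
  σ (λ p → w p * (m * m)) + σ (λ p → w p * ((n * x p) * (n * x p)))
    ≡⟨ cong₂ _+_ (trans (σ-*ʳ Σσ (m * m) w) (cong (_* (m * m)) Σw≡n))
                 (trans (σ-cong Σσ (λ p → pull-square n (w p) (x p))) (σ-*ˡ Σσ (n * n) _)) ⟩
  n * (m * m) + n * n * S₂                         ≡⟨ +-comm (n * (m * m)) _ ⟩
  n * n * S₂ + n * (m * m)                         ≡⟨ cong (_+ n * (m * m)) (*-assoc n n S₂) ⟩
  n * (n * S₂) + n * (m * m)                       ∎)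
  where
  open ≤-Reasoning
  deficit : _ → ℕ
  deficit p = m ∸ n * x p
  F S₂ : ℕ
  F  = σ (λ p → w p * (deficit p * deficit p))
  S₂ = σ (λ p → w p * (x p * x p))
  double : ∀ F n m → F + n * (m * m) + n * (m * m) ≡ F + 2 * (m * n) * m
  double = solve-∀
  regroup : ∀ m n w x → 2 * (m * n) * (w * x) ≡ w * (2 * (m * (n * x)))
  regroup = solve-∀
  pull-square : ∀ n w x → w * ((n * x) * (n * x)) ≡ n * n * (w * (x * x))
  pull-square = solve-∀

-- Combining Cauchy–Schwarz, the variance bound and a second-moment bound:
-- if U² ≤ n·F, F + n·m² ≤ n²·S₂, n·S₂ ≤ m² + Err and Err·κ ≤ c·N·m²,
-- then U²·κ ≤ c·N·(n·m)².
deficit-bound : ∀ (U F n m S₂ Err κ c N : ℕ) →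
                U * U ≤ n * F → F + n * (m * m) ≤ n * (n * S₂) → n * S₂ ≤ m * m + Err → Err * κ ≤ c * N * (m * m) →
                U * U * κ ≤ c * N * ((n * m) * (n * m))
deficit-bound U F n m S₂ Err κ c N U²≤nF variance second-moment error = begin
  U * U * κ               ≤⟨ *-monoˡ-≤ κ U²≤nF ⟩
  n * F * κ               ≤⟨ *-monoˡ-≤ κ nF≤n²Err ⟩
  n * n * Err * κ         ≡⟨ *-assoc (n * n) Err κ ⟩
  n * n * (Err * κ)       ≤⟨ *-monoʳ-≤ (n * n) error ⟩
  n * n * (c * N * (m * m)) ≡⟨ regroup n c N m ⟩
  c * N * ((n * m) * (n * m)) ∎
  where
  open ≤-Reasoning
  regroup : ∀ n c N m → n * n * (c * N * (m * m)) ≡ c * N * ((n * m) * (n * m))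
  regroup = solve-∀
  -- multiply the variance bound by n and insert the second-moment bound
  nF≤n²Err : n * F ≤ n * n * Err
  nF≤n²Err = +-cancelʳ-≤ (n * n * (m * m)) _ _ (begin
    n * F + n * n * (m * m)     ≡⟨ lhs n F m ⟩
    n * (F + n * (m * m))       ≤⟨ *-monoʳ-≤ n variance ⟩
    n * (n * (n * S₂))          ≡⟨ *-assoc n n (n * S₂) ⟨
    n * n * (n * S₂)            ≤⟨ *-monoʳ-≤ (n * n) second-moment ⟩
    n * n * (m * m + Err)       ≡⟨ rhs n m Err ⟩
    n * n * Err + n * n * (m * m) ∎)
    where lhs : ∀ n F m → n * F + n * n * (m * m) ≡ n * (F + n * (m * m))
          lhs = solve-∀
          rhs : ∀ n m E → n * n * (m * m + E) ≡ n * n * E + n * n * (m * m)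
          rhs = solve-∀

-- The collision terms of the second moment are O(N·m²/(kℓ)).  Here
-- m = 3MKL, and M·K = k·nS, N·L = ℓ·nT are the absorption identities.
module CollisionError (M N k ℓ d nS nT K L : ℕ)
                      (MK≡knS : M * K ≡ k * nS) (NL≡ℓnT : N * L ≡ ℓ * nT) (k≤M : k ≤ M) (ℓ≤N : ℓ ≤ N) where

  m : ℕ
  m = M * (3 * (K * L))

  variable-error : ∀ Dv → Dv ≤ M * (3 * (3 * d)) → K * K * (nT * L) * Dv * (k * ℓ) ≤ d * N * (m * m)
  variable-error Dv Dv≤ = begin
    K * K * (nT * L) * Dv * (k * ℓ)              ≤⟨ *-monoˡ-≤ (k * ℓ) (*-monoʳ-≤ (K * K * (nT * L)) Dv≤) ⟩
    K * K * (nT * L) * (M * (3 * (3 * d))) * (k * ℓ) ≡⟨ expand K nT L M d k ℓ ⟩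
    9 * d * K * K * L * M * k * (ℓ * nT)         ≡⟨ cong (9 * d * K * K * L * M * k *_) NL≡ℓnT ⟨
    9 * d * K * K * L * M * k * (N * L)          ≤⟨ *-monoˡ-≤ (N * L) (*-monoʳ-≤ (9 * d * K * K * L * M) k≤M) ⟩
    9 * d * K * K * L * M * M * (N * L)          ≡⟨ collect K N L M d ⟩
    d * N * (m * m)                              ∎
    where
    open ≤-Reasoning
    expand : ∀ K nT L M d k ℓ → K * K * (nT * L) * (M * (3 * (3 * d))) * (k * ℓ) ≡ 9 * d * K * K * L * M * k * (ℓ * nT)
    expand = solve-∀
    collect : ∀ K N L M d → 9 * d * K * K * L * M * M * (N * L) ≡ d * N * (M * (3 * (K * L)) * (M * (3 * (K * L))))
    collect = solve-∀

  clause-error : (nS * K * (L * L) + nS * K * (nT * L)) * (M * (3 * 3)) * (k * ℓ) ≤ 2 * N * (m * m)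
  clause-error = begin
    (nS * K * (L * L) + nS * K * (nT * L)) * (M * (3 * 3)) * (k * ℓ)
      ≡⟨ expand nS K L nT M k ℓ ⟩
    9 * K * L * L * M * ℓ * (k * nS) + 9 * K * L * M * (k * nS) * (ℓ * nT)
      ≡⟨ cong₂ (λ x y → 9 * K * L * L * M * ℓ * x + 9 * K * L * M * x * y) MK≡knS NL≡ℓnT ⟨
    9 * K * L * L * M * ℓ * (M * K) + 9 * K * L * M * (M * K) * (N * L)
      ≤⟨ +-monoˡ-≤ _ (*-monoˡ-≤ (M * K) (*-monoʳ-≤ (9 * K * L * L * M) ℓ≤N)) ⟩
    9 * K * L * L * M * N * (M * K) + 9 * K * L * M * (M * K) * (N * L)
      ≡⟨ collect K L M N ⟩
    2 * N * (m * m) ∎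
    where
    open ≤-Reasoning
    expand : ∀ nS K L nT M k ℓ → (nS * K * (L * L) + nS * K * (nT * L)) * (M * (3 * 3)) * (k * ℓ)
                                   ≡ 9 * K * L * L * M * ℓ * (k * nS) + 9 * K * L * M * (k * nS) * (ℓ * nT)
    expand = solve-∀
    collect : ∀ K L M N → 9 * K * L * L * M * N * (M * K) + 9 * K * L * M * (M * K) * (N * L)
                            ≡ 2 * N * (M * (3 * (K * L)) * (M * (3 * (K * L))))
    collect = solve-∀

  collision-error : ∀ Dv Dc → Dv ≤ M * (3 * (3 * d)) → Dc ≡ M * (3 * 3) →
    (K * K * (nT * L) * Dv + (nS * K * (L * L) + nS * K * (nT * L)) * Dc) * (k * ℓ) ≤ (2 + d) * N * (m * m)
  collision-error Dv Dc Dv≤ refl = begin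
    (K * K * (nT * L) * Dv + (nS * K * (L * L) + nS * K * (nT * L)) * Dc) * (k * ℓ)
      ≡⟨ *-distribʳ-+ (k * ℓ) (K * K * (nT * L) * Dv) ((nS * K * (L * L) + nS * K * (nT * L)) * Dc) ⟩
    K * K * (nT * L) * Dv * (k * ℓ) + (nS * K * (L * L) + nS * K * (nT * L)) * Dc * (k * ℓ)
      ≤⟨ +-mono-≤ (variable-error Dv Dv≤) clause-error ⟩
    d * N * (m * m) + 2 * N * (m * m)
      ≡⟨ sum d N (m * m) ⟩
    (2 + d) * N * (m * m) ∎
    where
    open ≤-Reasoning
    sum : ∀ d N x → d * N * x + 2 * N * x ≡ (2 + d) * N * x
    sum = solve-∀

ℕtoℚ-as-ℚᵘ : ∀ a → toℚᵘ (ℕtoℚ a) ≃ᵘ mkℚᵘ (ℤ.+ a) 0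
ℕtoℚ-as-ℚᵘ a = ℚP.toℚᵘ-fromℚᵘ (mkℚᵘ (ℤ.+ a) 0)

ℕtoℚ-* : ∀ a b → ℕtoℚ (a * b) ≡ ℕtoℚ a *ℚ ℕtoℚ b
ℕtoℚ-* a b = ℚP.toℚᵘ-injective
  (ℚᵘP.≃-trans (ℕtoℚ-as-ℚᵘ (a * b))
  (ℚᵘP.≃-trans (*≡* (cong (ℤ._* ℤ.+ 1) (ℤP.pos-* a b)))
               (ℚᵘP.≃-sym (ℚᵘP.≃-trans (ℚP.toℚᵘ-homo-* (ℕtoℚ a) (ℕtoℚ b))
                                       (ℚᵘP.*-cong (ℕtoℚ-as-ℚᵘ a) (ℕtoℚ-as-ℚᵘ b))))))

ℕtoℚ-+ : ∀ a b → ℕtoℚ (a + b) ≡ ℕtoℚ a +ℚ ℕtoℚ b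
ℕtoℚ-+ a b = ℚP.toℚᵘ-injective
  (ℚᵘP.≃-trans (ℕtoℚ-as-ℚᵘ (a + b))
  (ℚᵘP.≃-trans (*≡* (cong (ℤ._* ℤ.+ 1) (trans (ℤP.pos-+ a b)
                                            (sym (cong₂ ℤ._+_ (ℤP.*-identityʳ (ℤ.+ a)) (ℤP.*-identityʳ (ℤ.+ b)))))))
               (ℚᵘP.≃-sym (ℚᵘP.≃-trans (ℚP.toℚᵘ-homo-+ (ℕtoℚ a) (ℕtoℚ b))
                                       (ℚᵘP.+-cong (ℕtoℚ-as-ℚᵘ a) (ℕtoℚ-as-ℚᵘ b))))))

ℕtoℚ-mono : ∀ {a b} → a ≤ b → ℕtoℚ a ≤ℚ ℕtoℚ b
ℕtoℚ-mono {a} {b} a≤b = ℚP.toℚᵘ-cancel-≤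
  (ℚᵘP.≤-respˡ-≃ (ℚᵘP.≃-sym (ℕtoℚ-as-ℚᵘ a)) (ℚᵘP.≤-respʳ-≃ (ℚᵘP.≃-sym (ℕtoℚ-as-ℚᵘ b))
    (*≤* (subst₂ ℤ._≤_ (sym (ℤP.*-identityʳ (ℤ.+ a))) (sym (ℤP.*-identityʳ (ℤ.+ b))) (ℤ.+≤+ a≤b)))))

frac-cancel : ∀ a d → frac a (suc d) *ℚ ℕtoℚ (suc d) ≡ ℕtoℚ a
frac-cancel a d = ℚP.toℚᵘ-injective
  (ℚᵘP.≃-trans (ℚP.toℚᵘ-homo-* (frac a (suc d)) (ℕtoℚ (suc d)))
  (ℚᵘP.≃-trans (ℚᵘP.*-cong (ℚP.toℚᵘ-fromℚᵘ (mkℚᵘ (ℤ.+ a) d)) (ℕtoℚ-as-ℚᵘ (suc d)))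
  (ℚᵘP.≃-trans (*≡* (trans (ℤP.*-identityʳ _) (cong (λ z → ℤ.+ a ℤ.* ℤ.+ z) (sym (*-identityʳ (suc d))))))
               (ℚᵘP.≃-sym (ℕtoℚ-as-ℚᵘ a)))))

ℕtoℚ-nonNeg : ∀ a → NonNegative (ℕtoℚ a)
ℕtoℚ-nonNeg a = ℚP.normalize-nonNeg a 1

ℕtoℚ-pos : ∀ a → Positive (ℕtoℚ (suc a))
ℕtoℚ-pos a = ℚP.normalize-pos (suc a) 1

scaled-gap : ∀ (P Q n D R U : ℕ) → P * suc D * suc R ≤ Q * suc n * suc R + U →
             (frac P (suc n) -ℚ frac Q (suc D)) *ℚ ℕtoℚ (suc n * suc D * suc R) ≤ℚ ℕtoℚ U
scaled-gap P Q n D R U numerators = begin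
  (p -ℚ q) *ℚ ℕtoℚ (suc n * suc D * suc R)
    ≡⟨ cong ((p -ℚ q) *ℚ_) (trans (ℕtoℚ-* (suc n * suc D) (suc R)) (cong (_*ℚ r) (ℕtoℚ-* (suc n) (suc D)))) ⟩
  (p -ℚ q) *ℚ (ñ *ℚ d̃ *ℚ r)
    ≡⟨ solve 5 (λ p q a b c → (p :- q) :* (a :* b :* c) := (p :* a) :* (b :* c) :- (q :* b) :* (a :* c)) refl p q ñ d̃ r ⟩
  (p *ℚ ñ) *ℚ (d̃ *ℚ r) -ℚ (q *ℚ d̃) *ℚ (ñ *ℚ r)
    ≡⟨ cong₂ _-ℚ_ (cong₂ _*ℚ_ (frac-cancel P n) (sym (ℕtoℚ-* (suc D) (suc R))))
                  (cong₂ _*ℚ_ (frac-cancel Q D) (sym (ℕtoℚ-* (suc n) (suc R)))) ⟩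
  ℕtoℚ P *ℚ ℕtoℚ (suc D * suc R) -ℚ ℕtoℚ Q *ℚ ℕtoℚ (suc n * suc R)
    ≡⟨ cong₂ _-ℚ_ (trans (sym (ℕtoℚ-* P _)) (cong ℕtoℚ (sym (*-assoc P (suc D) (suc R)))))
                  (trans (sym (ℕtoℚ-* Q _)) (cong ℕtoℚ (sym (*-assoc Q (suc n) (suc R))))) ⟩
  ℕtoℚ (P * suc D * suc R) -ℚ b
    ≤⟨ ℚP.+-monoˡ-≤ (ℚ.-_ b) (ℚP.≤-trans (ℕtoℚ-mono numerators) (ℚP.≤-reflexive (ℕtoℚ-+ (Q * suc n * suc R) U))) ⟩
  (b +ℚ ℕtoℚ U) -ℚ b
    ≡⟨ solve 2 (λ b u → (b :+ u) :- b := u) refl b (ℕtoℚ U) ⟩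
  ℕtoℚ U ∎
  where
  open ℚP.≤-Reasoning
  open +-*-Solver
  p = frac P (suc n)
  q = frac Q (suc D)
  ñ = ℕtoℚ (suc n)
  d̃ = ℕtoℚ (suc D)
  r = ℕtoℚ (suc R)
  b = ℕtoℚ (Q * suc n * suc R)

square-mono : ∀ x y → NonNegative x → NonNegative y → x ≤ℚ y → x *ℚ x ≤ℚ y *ℚ y
square-mono x y x≥0 y≥0 x≤y = ℚP.≤-trans (ℚP.*-monoʳ-≤-nonNeg x {{x≥0}} x≤y) (ℚP.*-monoˡ-≤-nonNeg y {{y≥0}} x≤y)

-- The gap bound from integer data.  If P/n and Q/D satisfy
-- P·D·R ≤ Q·n·R + U and U²·kℓ ≤ c²·N·(nDR)², then either P/n ≤ Q/D or
-- (P/n − Q/D)²·kℓ ≤ c²·N: multiply the gap by nDR and square.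
gap-bound : ∀ (P Q n D R U k ℓ N c : ℕ) → 0 < n → 0 < D → 0 < R →
            P * D * R ≤ Q * n * R + U →
            U * U * (k * ℓ) ≤ (c * c) * N * ((n * D * R) * (n * D * R)) →
            GapBound (ℕtoℚ c) N k ℓ (frac P n) (frac Q D)
gap-bound P Q (suc n) (suc D) (suc R) U k ℓ N c _ _ _ numerators deficit
  with frac P (suc n) -ℚ frac Q (suc D) ≤ℚ? ℕtoℚ 0
... | yes gap≤0 = inj₁ gap≤0
... | no  gap≰0 = inj₂ (ℚP.*-cancelʳ-≤-pos (r *ℚ r) {{ℚP.pos*pos⇒pos r {{r-pos}} r {{r-pos}}}} (begin
  (x *ℚ x) *ℚ κ *ℚ (r *ℚ r)             ≡⟨ solve 3 (λ x κ r → (x :* x) :* κ :* (r :* r) := (x :* r) :* (x :* r) :* κ) refl x κ r ⟩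
  (x *ℚ r) *ℚ (x *ℚ r) *ℚ κ             ≤⟨ ℚP.*-monoʳ-≤-nonNeg κ {{ℕtoℚ-nonNeg (k * ℓ)}}
                                              (square-mono (x *ℚ r) (ℕtoℚ U) xr≥0 (ℕtoℚ-nonNeg U)
                                                           (scaled-gap P Q n D R U numerators)) ⟩
  ℕtoℚ U *ℚ ℕtoℚ U *ℚ κ                 ≡⟨ trans (cong (_*ℚ κ) (sym (ℕtoℚ-* U U))) (sym (ℕtoℚ-* (U * U) (k * ℓ))) ⟩
  ℕtoℚ (U * U * (k * ℓ))                ≤⟨ ℕtoℚ-mono deficit ⟩
  ℕtoℚ ((c * c) * N * (nDR * nDR))      ≡⟨ trans (ℕtoℚ-* ((c * c) * N) (nDR * nDR))
                                               (cong₂ _*ℚ_ (trans (ℕtoℚ-* (c * c) N) (cong (_*ℚ ℕtoℚ N) (ℕtoℚ-* c c)))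
                                                           (ℕtoℚ-* nDR nDR)) ⟩
  (ℕtoℚ c *ℚ ℕtoℚ c) *ℚ ℕtoℚ N *ℚ (r *ℚ r) ∎))
  where
  open ℚP.≤-Reasoning
  open +-*-Solver
  x = frac P (suc n) -ℚ frac Q (suc D)
  κ = ℕtoℚ (k * ℓ)
  nDR = suc n * suc D * suc R
  r = ℕtoℚ nDR
  r-pos : Positive r
  r-pos = ℕtoℚ-pos (pred nDR)
  xr≥0 : NonNegative (x *ℚ r)
  xr≥0 = ℚP.nonNeg*nonNeg⇒nonNeg x {{ℚ.nonNegative (ℚP.<⇒≤ (ℚP.≰⇒> gap≰0))}} r {{ℚP.pos⇒nonNeg r {{r-pos}}}}

binomial-pos : ∀ n k → k ≤ n → 0 < n choose k
binomial-pos n       zero    _         = s≤s z≤n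
binomial-pos (suc n) (suc k) (s≤s k≤n) =
  subst (0 <_) (pascal n k) (≤-trans (binomial-pos n k k≤n) (m≤n+m (n choose k) (n choose suc k)))

module Analysis {N′ M′ : ℕ} (φ : CNF (suc N′) (suc M′)) (d : ℕ) (regular : Regular d φ)
                (k′ ℓ′ : ℕ) (k≤M : suc k′ ≤ suc M′) (ℓ≤N : suc ℓ′ ≤ suc N′)
                (A : RepStrat₁ (suc M′)) (B : RepStrat₂ (suc N′)) where
  M N k ℓ : ℕ
  M = suc M′
  N = suc N′
  k = suc k′
  ℓ = suc ℓ′

  -- numbers of questions to each prover, of question pairs, and of
  -- questions containing a fixed clause resp. variable
  nS nT n K L : ℕ
  nS = M choose k
  nT = N choose ℓ
  n  = nS * nT
  K  = through M′ k
  L  = through N′ ℓ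

  open Setting φ
  private module Extract = BestResponse φ k ℓ A B K L (count-through M′ k) (count-through N′ ℓ)
  open Extract public using (a; b)
  open Extract using (W; checkedAccept; best-response)
  open Moments φ k ℓ nS nT K L (count-through M′ k) (count-through N′ ℓ) (pair-count-bound M′ k) (pair-count-bound N′ ℓ)
    using (m; mean; secondMoment; second-moment-bound; variableWeight; clauseWeight)
  open Collisions φ
  open CollisionError M N k ℓ d nS nT K L (sym (absorption M k)) (sym (absorption N ℓ)) k≤M ℓ≤N
    using (collision-error)

  m-closed-form : m ≡ M * (3 * (K * L))
  m-closed-form = trans (σ-cong (sumFin-isSum M) (λ _ → sumFin-const 3 (K * L))) (sumFin-const M (3 * (K * L)))

  legal-count : ΣP (legal k ℓ) ≡ n
  legal-count = trans (sym (σ-product (sumSub-isSum M) (sumSub-isSum N) (hasSize k) (hasSize ℓ)))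
                      (cong₂ _*_ (count-subsets M k) (count-subsets N ℓ))

  won : Pair → Bool
  won (S , T) = acceptsRep φ S T (A S) (B T)

  wins : Pair → ℕ
  wins p = ind (won p)

  -- numerator of valueRep: the number of legal pairs won
  P : ℕ
  P = sumSub M (λ S → sumSub N (λ T → ind (⌊ ∣ S ∣ ≟ k ⌋ ∧ ⌊ ∣ T ∣ ≟ ℓ ⌋ ∧ acceptsRep φ S T (A S) (B T))))

  P-as-sum : P ≡ ΣP (λ p → legal k ℓ p * wins p)
  P-as-sum = σ-cong ΣP-isSum (λ (S , T) →
    trans (ind-∧ ⌊ ∣ S ∣ ≟ k ⌋ _)
   (trans (cong (hasSize k S *_) (ind-∧ ⌊ ∣ T ∣ ≟ ℓ ⌋ _))
          (sym (*-assoc (hasSize k S) (hasSize ℓ T) (wins (S , T))))))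

  wins-checked : ∀ p → wins p * X p ≤ ΣE (checkedAccept p)
  wins-checked (S , T) =
    allFin-bound M (λ i → allFin 3 (check i)) (λ i → sumFin 3 (λ t → covered (S , T) (i , t))) (λ i → sumFin 3 (λ t → checkedAccept (S , T) (i , t)))
      (λ i → allFin-bound 3 (check i) (λ t → covered (S , T) (i , t)) (λ t → checkedAccept (S , T) (i , t))
        (λ t → passed-check (lookup S i) (lookup T (var φ i t)) (accepts φ i t (A S i) (B T (var φ i t)))))
    where
          check : Fin M → Fin 3 → Bool
          check i t = not (lookup S i ∧ lookup T (var φ i t)) ∨ accepts φ i t (A S i) (B T (var φ i t))

  deficit : Pair → ℕ
  deficit p = m ∸ n * X p

  U : ℕ
  U = ΣP (λ p → legal k ℓ p * deficit p)

  won-pairs : m * P ≤ n * W + U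
  won-pairs = begin
    m * P                                              ≡⟨ cong (m *_) P-as-sum ⟩
    m * ΣP (λ p → legal k ℓ p * wins p)                ≡⟨ σ-*ˡ ΣP-isSum m (λ p → legal k ℓ p * wins p) ⟨
    ΣP (λ p → m * (legal k ℓ p * wins p))              ≤⟨ σ-mono ΣP-isSum (λ p → accepted-or-deficit (legal k ℓ p) (won p) m (n * X p)) ⟩
    ΣP (λ p → legal k ℓ p * wins p * (n * X p) + legal k ℓ p * deficit p)
                                                       ≡⟨ σ-+ ΣP-isSum (λ p → legal k ℓ p * wins p * (n * X p)) (λ p → legal k ℓ p * deficit p) ⟩
    ΣP (λ p → legal k ℓ p * wins p * (n * X p)) + U   ≤⟨ +-monoˡ-≤ U (σ-mono ΣP-isSum checked) ⟩
    ΣP (λ p → n * (legal k ℓ p * ΣE (checkedAccept p))) + U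
                                                       ≡⟨ cong (_+ U) (σ-*ˡ ΣP-isSum n (λ p → legal k ℓ p * ΣE (checkedAccept p))) ⟩
    n * W + U                                          ∎
    where
    open ≤-Reasoning
    regroup : ∀ l w n x → l * w * (n * x) ≡ n * (l * (w * x))
    regroup = solve-∀
    checked : ∀ p → legal k ℓ p * wins p * (n * X p) ≤ n * (legal k ℓ p * ΣE (checkedAccept p))
    checked p = ≤-trans (≤-reflexive (regroup (legal k ℓ p) (wins p) n (X p)))
                        (*-monoʳ-≤ n (*-monoʳ-≤ (legal k ℓ p) (wins-checked p)))

  deficit-estimate : U * U * (k * ℓ) ≤ (2 + d) * N * ((n * m) * (n * m))
  deficit-estimate =
    deficit-bound U F n m secondMoment Err (k * ℓ) (2 + d) N
      (subst (λ z → U * U ≤ z * F) legal-count (cauchy-schwarz ΣP-isSum (legal k ℓ) deficit))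
      (deficit-variance ΣP-isSum (legal k ℓ) X n m legal-count mean)
      second-moment-bound
      (subst (λ z → Err * (k * ℓ) ≤ (2 + d) * N * (z * z)) (sym m-closed-form)
        (collision-error sameVariable sameClause (same-variable-bound d regular) same-clause-count))
    where
    F Err : ℕ
    F   = ΣP (λ p → legal k ℓ p * (deficit p * deficit p))
    Err = variableWeight * sameVariable + clauseWeight * sameClause

  gap : GapBound (ℕtoℚ (2 + d)) N k ℓ (valueRep φ k ℓ A B) (valueG φ a b)
  gap = gap-bound P Q n (3 * M) (K * L) U k ℓ N (2 + d)
          (*-mono-< (binomial-pos M k k≤M) (binomial-pos N ℓ ℓ≤N)) (s≤s z≤n)
          (*-mono-< (binomial-pos M′ k′ (≤-pred k≤M)) (binomial-pos N′ ℓ′ (≤-pred ℓ≤N)))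
          numerators deficit′
    where
    Q : ℕ
    Q = accepted a b
    nm-closed-form : n * m ≡ n * (3 * M) * (K * L)
    nm-closed-form = trans (cong (n *_) m-closed-form) (regroup n M (K * L))
      where regroup : ∀ n M x → n * (M * (3 * x)) ≡ n * (3 * M) * x
            regroup = solve-∀
    numerators : P * (3 * M) * (K * L) ≤ Q * n * (K * L) + U
    numerators = begin
      P * (3 * M) * (K * L)    ≡⟨ trans (regroup₁ P M (K * L)) (cong (_* P) (sym m-closed-form)) ⟩
      m * P                    ≤⟨ won-pairs ⟩
      n * W + U                ≤⟨ +-monoˡ-≤ U (*-monoʳ-≤ n best-response) ⟩
      n * (L * (K * Q)) + U    ≡⟨ cong (_+ U) (regroup₂ n L K Q) ⟩
      Q * n * (K * L) + U      ∎
      where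
      open ≤-Reasoning
      regroup₁ : ∀ P M x → P * (3 * M) * x ≡ M * (3 * x) * P
      regroup₁ = solve-∀
      regroup₂ : ∀ n L K Q → n * (L * (K * Q)) ≡ Q * n * (K * L)
      regroup₂ = solve-∀
    deficit′ : U * U * (k * ℓ) ≤ ((2 + d) * (2 + d)) * N * ((n * (3 * M) * (K * L)) * (n * (3 * M) * (K * L)))
    deficit′ = subst (λ z → U * U * (k * ℓ) ≤ ((2 + d) * (2 + d)) * N * (z * z)) nm-closed-form
                 (≤-trans deficit-estimate (*-monoˡ-≤ ((n * m) * (n * m)) (*-monoˡ-≤ N (m≤m*n (2 + d) (2 + d)))))

-- Theorem 26: ω(G_φ) ≥ ω(G_φ^{k×ℓ}) − C·√(N/(kℓ)) with C = 2 + d, in the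
-- strategy-wise form: every strategy pair for the repeated game is matched,
-- up to the gap, by a strategy pair for G_φ.
theorem26 : ∀ (d : ℕ) → ∃[ C ] (0ℚ ≤ℚ C ×
    (∀ (N M : ℕ) (φ : CNF N M) → DistinctVars φ → Regular d φ →
    ∀ (k ℓ : ℕ) → 1 ≤ k → k ≤ M → 1 ≤ ℓ → ℓ ≤ N →
    ∀ (A : RepStrat₁ M) (B : RepStrat₂ N) →
    ∃[ a ] ∃[ b ] GapBound C N k ℓ (valueRep φ k ℓ A B) (valueG φ a b)))
theorem26 d = ℕtoℚ (2 + d) , ℚP.nonNegative⁻¹ (ℕtoℚ (2 + d)) {{ℕtoℚ-nonNeg (2 + d)}} , extract
  where
  extract : ∀ (N M : ℕ) (φ : CNF N M) → DistinctVars φ → Regular d φ →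
            ∀ (k ℓ : ℕ) → 1 ≤ k → k ≤ M → 1 ≤ ℓ → ℓ ≤ N →
            ∀ (A : RepStrat₁ M) (B : RepStrat₂ N) →
            ∃[ a ] ∃[ b ] GapBound (ℕtoℚ (2 + d)) N k ℓ (valueRep φ k ℓ A B) (valueG φ a b)
  extract (suc N′) (suc M′) φ _ regular (suc k′) (suc ℓ′) _ k≤M _ ℓ≤N A B = a , b , gap
    where open Analysis φ d regular k′ ℓ′ k≤M ℓ≤N A B
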